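{- Let $p=(\pi,R)$ be a mesh pattern with $\pi\in\mathfrak{S}_k$, and let $\bar p=(\pi,R^c)$ where $R^c=[0,k]^2\setminus R$. Then for every permutation $\tau\in\mathfrak{S}$, $$p(\tau)=\sum_{\sigma\in\mathfrak{S}}\lambda(\sigma)\,\sigma(\tau),\qquad\text{where }\lambda(\sigma)=(-1)^{|\sigma|-|\pi|}\,\bar p(\sigma),$$ and $\sigma(\tau)$ denotes the number of classical occurrences of $\sigma$ in $\tau$ (the sum is finite since $\sigma(\tau)=0$ when $|\sigma|>|\tau|$). Moreover, these coefficients $\lambda(\sigma)$ are the unique ones with this property.
   Context: $\mathfrak{S}_n$ is the set of permutations of $[1,n]$ and $\mathfrak{S}=\bigcup_{n\ge0}\mathfrak{S}_n$; $|\pi|$ is the length of $\pi$. A mesh pattern is a pair $p=(\pi,R)$ with $\pi\in\mathfrak{S}_k$ and $R\subseteq[0,k]\times[0,k]$. For $\tau\in\mathfrak{S}_n$ with plot $G(\tau)=\{(i,\tau(i)):i\in[1,n]\}$, an occurrence of $p$ in $\tau$ is a subset $\omega\subseteq G(\tau)$ for which there exist order-preserving injections $\alpha,\beta:[1,k]\to[1,n]$ with (i) $\omega=\{(\alpha(i),\beta(j)):(i,j)\in G(\pi)\}$, and (ii) for every $(i,j)\in R$, the box $R_{ij}=[\alpha(i)+1,\alpha(i+1)-1]\times[\beta(j)+1,\beta(j+1)-1]$ contains no point of $G(\tau)$, where $\alpha(0)=\beta(0)=0$ and $\alpha(k+1)=\beta(k+1)=n+1$. $p(\tau)$ denotes the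 number of occurrences of $p$ in $\tau$. A classical pattern $\sigma$ is identified with the mesh pattern $(\sigma,\emptyset)$, so $\sigma(\tau)$ is the number of classical occurrences of $\sigma$ in $\tau$. -}

module Defs where

open import Data.Bool using (Bool; true; false; T; not; _∧_; _∨_; if_then_else_)
open import Data.Bool.Properties using (T?)
open import Data.Nat using (ℕ; zero; suc; _<ᵇ_; _≡ᵇ_; _∸_)
open import Data.Fin using (Fin; toℕ)
open import Data.Vec using (Vec; []; _∷_; lookup; toList)
open import Data.List using (List; []; _∷_; map; concatMap; allFin; length; filterᵇ; mapMaybe; upTo; foldr)
open import Data.Bool.ListAction using (all; any)
open import Data.Maybe using (Maybe; just; nothing)
open import Data.Product using (Σ; _,_; proj₁)
open import Data.Integer using (ℤ; +_; -_; _*_; _+_; _^_)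
open import Relation.Nullary using (yes; no)

vecsOf : {A : Set} → List A → (k : ℕ) → List (Vec A k)
vecsOf xs zero    = [] ∷ []
vecsOf xs (suc k) = concatMap (λ x → map (x ∷_) (vecsOf xs k)) xs

allF : (k : ℕ) → (Fin k → Bool) → Bool
allF k P = all P (allFin k)

anyF : (k : ℕ) → (Fin k → Bool) → Bool
anyF k P = any P (allFin k)

infix 4 _=ᶠ_
_=ᶠ_ : {n : ℕ} → Fin n → Fin n → Bool
a =ᶠ b = toℕ a ≡ᵇ toℕ b

_⇒ᵇ_ : Bool → Bool → Bool
a ⇒ᵇ b = not a ∨ b

-- Permutations of [1,n]: the one-line notation v = (τ(1),…,τ(n)),
-- stored 0-based as a vector of Fin n with pairwise distinct entries.

distinct : {n k : ℕ} → Vec (Fin n) k → Bool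
distinct {n} {k} v =
  allF k (λ i → allF k (λ j → (lookup v i =ᶠ lookup v j) ⇒ᵇ (i =ᶠ j)))

Perm : ℕ → Set
Perm n = Σ (Vec (Fin n) n) (λ v → T (distinct v))

infix 10 _⟨_⟩
_⟨_⟩ : {n : ℕ} → Perm n → Fin n → Fin n
τ ⟨ x ⟩ = lookup (proj₁ τ) x

allPerms : (n : ℕ) → List (Perm n)
allPerms n = mapMaybe toPerm (vecsOf (allFin n) n)
  where
  toPerm : Vec (Fin n) n → Maybe (Perm n)
  toPerm v with T? (distinct v)
  ... | yes d = just (v , d)
  ... | no _  = nothing

record Mesh : Set where
  constructor mesh
  field
    k  : ℕ
    π  : Perm k
    R  : Fin (suc k) → Fin (suc k) → Bool

open Mesh public

complement : Mesh → Mesh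
complement (mesh k π R) = mesh k π (λ i j → not (R i j))

classical : {m : ℕ} → Perm m → Mesh
classical {m} σ = mesh m σ (λ _ _ → false)

increasing : {n k : ℕ} → Vec (Fin n) k → Bool
increasing {n} {k} α =
  allF k (λ i → allF k (λ j → (toℕ i <ᵇ toℕ j) ⇒ᵇ (toℕ (lookup α i) <ᵇ toℕ (lookup α j))))

at : ℕ → List ℕ → ℕ → ℕ
at d []       _       = d
at d (x ∷ xs) zero    = x
at d (x ∷ xs) (suc i) = at d xs i

-- 1-based extension: ext α 0 = 0, ext α i = α(i) (1 ≤ i ≤ k), ext α (k+1) = n+1
ext : {n k : ℕ} → Vec (Fin n) k → ℕ → ℕ
ext {n} α = at (suc n) (0 ∷ map (λ a → suc (toℕ a)) (toList α))

infix 4 _<ᵇ_<ᵇ_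
_<ᵇ_<ᵇ_ : ℕ → ℕ → ℕ → Bool
a <ᵇ b <ᵇ c = (a <ᵇ b) ∧ (b <ᵇ c)

-- A subset ω ⊆ G(τ) is described by S : Vec Bool n  (point (x, τ(x)) ∈ ω iff S[x]).
-- isOccWith p τ S α β : α, β witness that ω is an occurrence of p in τ.
isOccWith : (p : Mesh) {n : ℕ} → Perm n → Vec Bool n →
            Vec (Fin n) (k p) → Vec (Fin n) (k p) → Bool
isOccWith (mesh k π R) {n} τ S α β =
  increasing α ∧ increasing β
  -- (i)  ω = { (α(i), β(π(i))) : i ∈ [1,k] }
  ∧ allF k (λ i → lookup S (lookup α i) ∧ (τ ⟨ lookup α i ⟩ =ᶠ lookup β (π ⟨ i ⟩)))
  ∧ allF n (λ x → lookup S x ⇒ᵇ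
       anyF k (λ i → (lookup α i =ᶠ x) ∧ (lookup β (π ⟨ i ⟩) =ᶠ τ ⟨ x ⟩)))
  -- (ii) every shaded box R_ij contains no point of G(τ)
  ∧ allF (suc k) (λ i → allF (suc k) (λ j → R i j ⇒ᵇ
       allF n (λ x → not ( (ext α (toℕ i) <ᵇ suc (toℕ x) <ᵇ ext α (suc (toℕ i)))
                         ∧ (ext β (toℕ j) <ᵇ suc (toℕ (τ ⟨ x ⟩)) <ᵇ ext β (suc (toℕ j)))))))

isOcc : (p : Mesh) {n : ℕ} → Perm n → Vec Bool n → Bool
isOcc p {n} τ S =
  any (λ α → any (λ β → isOccWith p τ S α β) (vecsOf (allFin n) (k p)))
      (vecsOf (allFin n) (k p))

occ : Mesh → {n : ℕ} → Perm n → ℕ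
occ p {n} τ = length (filterᵇ (isOcc p τ) (vecsOf (true ∷ false ∷ []) n))

sumℤ : List ℤ → ℤ
sumℤ = foldr _+_ (+ 0)

-- Σ_{σ ∈ 𝔖} c(σ) σ(τ); terms with |σ| > |τ| vanish, so we sum over |σ| ≤ |τ|
expand : ((m : ℕ) → Perm m → ℤ) → {n : ℕ} → Perm n → ℤ
expand c {n} τ =
  sumℤ (map (λ m → sumℤ (map (λ σ → c m σ * + occ (classical σ) τ) (allPerms m)))
            (upTo (suc n)))

lam : Mesh → (m : ℕ) → Perm m → ℤ
lam p m σ = ((- (+ 1)) ^ (m ∸ k p)) * + occ (complement p) σ

-- An occurrence of p in τ is determined by its point set S: S has k points forming the pattern π, and every
-- other point of τ avoids the shaded boxes of the mesh drawn through S.  Dually, an occurrence of p̄ in the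
-- pattern of τ at a set of positions T is a set S ⊆ T forming π such that every point of T ∖ S lies in a shaded
-- box of p.  Hence Σ_T (-1)^{|T|-k} p̄(τ|T) = Σ_S [S forms π] Σ_{T ⊇ S} (-1)^{|T∖S|} [T ∖ S ⊆ shaded], and by
-- inclusion–exclusion the inner sum is [no point outside S is shaded], which leaves p(τ).  As
-- Σ_σ λ(σ) σ(τ) = Σ_T λ(τ|T), the coefficients are unique by induction on |σ|: for τ = σ the full set T
-- contributes λ(σ) and every other T a shorter pattern.

module Submission where

open import Defs
open import Data.Bool using (Bool; true; false; not; _∧_; T)
open import Data.Bool.Properties using (T?; T-≡; T-irrelevant)
open import Data.Bool.ListAction using (all; any)
open import Data.Empty using (⊥; ⊥-elim)
open import Data.Fin as Fin using (Fin; zero; suc; toℕ; fromℕ; fromℕ<; punchOut)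
import Data.Fin.Properties as Finₚ
open import Data.Fin.Permutation using (permutation)
open import Data.Integer using (ℤ; +_; -_; _+_; _-_; _*_; _^_)
import Data.Integer.Properties as ℤₚ
open import Data.Integer.Tactic.RingSolver using (solve-∀)
open import Data.List using (List; []; _∷_; map; _++_; length; filterᵇ; mapMaybe; applyUpTo; upTo; allFin; tabulate; concatMap)
import Data.List.Properties as Listₚ
open import Data.List.Membership.Propositional using (_∈_; lose)
import Data.List.Membership.Propositional.Properties as ∈ₚ
import Data.List.Relation.Unary.All.Properties as Allₚ
import Data.List.Relation.Unary.Any as Any
import Data.List.Relation.Unary.Any.Properties as Anyₚ
open import Data.Maybe using (Maybe; just; nothing; maybe)
open import Data.Nat as ℕ using (ℕ; zero; suc; _<_; _≤_; _<ᵇ_; _≡ᵇ_; _∸_; z≤n; s≤s; z<s; s<s)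
import Data.Nat.Properties as ℕₚ
open import Data.Nat.Induction using (<-rec)
open import Data.Product using (Σ; ∃; _×_; _,_; proj₁; proj₂)
open import Data.Sum using (_⊎_; inj₁; inj₂)
open import Data.Vec as Vec using (Vec; []; _∷_; lookup)
import Data.Vec.Properties as Vecₚ
open import Function using (Equivalence; _∘_)
open import Relation.Binary using (tri<; tri≈; tri>)
open import Relation.Binary.PropositionalEquality
open import Relation.Nullary using (¬_; yes; no)
import Algebra.Properties.CommutativeMonoid.Sum as MonoidSum
open import Algebra.Properties.CommutativeSemigroup ℤₚ.+-commutativeSemigroup using (interchange)
open import Algebra.Properties.CommutativeSemigroup ℕₚ.+-commutativeSemigroup using ()
  renaming (interchange to ℕ-interchange)

≡true⇒T : ∀ {b} → b ≡ true → T b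
≡true⇒T = Equivalence.from T-≡

T⇒≡true : ∀ {b} → T b → b ≡ true
T⇒≡true = Equivalence.to T-≡

∧-elimˡ : ∀ {a b} → a ∧ b ≡ true → a ≡ true
∧-elimˡ {true} _ = refl

∧-elimʳ : ∀ {a b} → a ∧ b ≡ true → b ≡ true
∧-elimʳ {true} h = h

∧-elim : ∀ {a b} → a ∧ b ≡ true → a ≡ true × b ≡ true
∧-elim {true} h = refl , h

∧-intro : ∀ {a b} → a ≡ true → b ≡ true → a ∧ b ≡ true
∧-intro refl refl = refl

⇒ᵇ-elim : ∀ {a b} → (a ⇒ᵇ b) ≡ true → a ≡ true → b ≡ true
⇒ᵇ-elim {true} h refl = h

⇒ᵇ-intro : ∀ {a b} → (a ≡ true → b ≡ true) → (a ⇒ᵇ b) ≡ true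
⇒ᵇ-intro {true} f = f refl
⇒ᵇ-intro {false} _ = refl

not-≡true : ∀ {a} → not a ≡ true → a ≡ false
not-≡true {false} _ = refl

not-≡false : ∀ {a} → a ≡ false → not a ≡ true
not-≡false refl = refl

true≢false : ∀ {a} → a ≡ true → a ≡ false → ⊥
true≢false refl ()

≢true⇒≡false : ∀ {a} → (a ≡ true → ⊥) → a ≡ false
≢true⇒≡false {true} a≢true = ⊥-elim (a≢true refl)
≢true⇒≡false {false} _ = refl

bool-ext : ∀ {a b} → (a ≡ true → b ≡ true) → (b ≡ true → a ≡ true) → a ≡ b
bool-ext {true} {true} _ _ = refl
bool-ext {true} {false} f _ = sym (f refl)
bool-ext {false} {true} _ g = g refl
bool-ext {false} {false} _ _ = refl

<ᵇ-intro : ∀ {m n} → m < n → (m <ᵇ n) ≡ true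
<ᵇ-intro m<n = T⇒≡true (ℕₚ.<⇒<ᵇ m<n)

<ᵇ-elim : ∀ {m n} → (m <ᵇ n) ≡ true → m < n
<ᵇ-elim {m} {n} h = ℕₚ.<ᵇ⇒< m n (≡true⇒T h)

≡ᵇ-intro : ∀ {m n} → m ≡ n → (m ≡ᵇ n) ≡ true
≡ᵇ-intro {m} {n} m≡n = T⇒≡true (ℕₚ.≡⇒≡ᵇ m n m≡n)

≡ᵇ-elim : ∀ {m n} → (m ≡ᵇ n) ≡ true → m ≡ n
≡ᵇ-elim {m} {n} h = ℕₚ.≡ᵇ⇒≡ m n (≡true⇒T h)

≢⇒≡ᵇ-false : ∀ {m n} → m ≢ n → (m ≡ᵇ n) ≡ false
≢⇒≡ᵇ-false {m} {n} m≢n with m ≡ᵇ n in eq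
... | true = ⊥-elim (m≢n (≡ᵇ-elim eq))
... | false = refl

=ᶠ-intro : ∀ {n} {a b : Fin n} → a ≡ b → (a =ᶠ b) ≡ true
=ᶠ-intro {a = a} refl = ≡ᵇ-intro {toℕ a} refl

=ᶠ-elim : ∀ {n} {a b : Fin n} → (a =ᶠ b) ≡ true → a ≡ b
=ᶠ-elim h = Finₚ.toℕ-injective (≡ᵇ-elim h)

allF-elim : ∀ k {P : Fin k → Bool} → allF k P ≡ true → ∀ i → P i ≡ true
allF-elim k {P} h i = T⇒≡true (Allₚ.tabulate⁻ (Allₚ.all⁺ P (allFin k) (≡true⇒T h)) i)

allF-intro : ∀ k {P : Fin k → Bool} → (∀ i → P i ≡ true) → allF k P ≡ true
allF-intro k {P} h = T⇒≡true (Allₚ.all⁻ P (Allₚ.tabulate⁺ (λ i → ≡true⇒T (h i))))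

anyF-elim : ∀ k {P : Fin k → Bool} → anyF k P ≡ true → ∃ λ i → P i ≡ true
anyF-elim k {P} h with Anyₚ.tabulate⁻ (Anyₚ.any⁻ P (allFin k) (≡true⇒T h))
... | i , Pi = i , T⇒≡true Pi

anyF-intro : ∀ k {P : Fin k → Bool} i → P i ≡ true → anyF k P ≡ true
anyF-intro k {P} i Pi = T⇒≡true (Anyₚ.any⁺ P (Anyₚ.tabulate⁺ i (≡true⇒T Pi)))

allF-cong : ∀ n {P Q : Fin n → Bool} → (∀ x → P x ≡ Q x) → allF n P ≡ allF n Q
allF-cong n {P} {Q} P≗Q = bool-ext
  (λ h → allF-intro n λ x → trans (sym (P≗Q x)) (allF-elim n h x))
  (λ h → allF-intro n λ x → trans (P≗Q x) (allF-elim n h x))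

any-elim : {A : Set} (P : A → Bool) (xs : List A) → any P xs ≡ true → ∃ λ x → P x ≡ true
any-elim P xs h with Any.satisfied (Anyₚ.any⁻ P xs (≡true⇒T h))
... | x , Px = x , T⇒≡true Px

∈-vecsOf : {A : Set} (xs : List A) {k : ℕ} (v : Vec A k) → (∀ i → lookup v i ∈ xs) → v ∈ vecsOf xs k
∈-vecsOf xs [] _ = Any.here refl
∈-vecsOf xs (a ∷ v) h =
  ∈ₚ.∈-concatMap⁺ (λ x → map (x ∷_) (vecsOf xs _))
    (lose (h zero) (∈ₚ.∈-map⁺ (a ∷_) (∈-vecsOf xs v (h ∘ suc))))

any-vecsOf-intro : ∀ n k (P : Vec (Fin n) k → Bool) v → P v ≡ true → any P (vecsOf (allFin n) k) ≡ true
any-vecsOf-intro n k P v Pv =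
  T⇒≡true (Anyₚ.any⁺ P (lose (∈-vecsOf (allFin n) v (∈ₚ.∈-allFin ∘ lookup v)) (≡true⇒T Pv)))

𝟙 : Bool → ℤ
𝟙 true = + 1
𝟙 false = + 0

sumℤ-map-++ : {A : Set} (f : A → ℤ) (xs ys : List A) →
  sumℤ (map f (xs ++ ys)) ≡ sumℤ (map f xs) + sumℤ (map f ys)
sumℤ-map-++ f [] ys = sym (ℤₚ.+-identityˡ _)
sumℤ-map-++ f (x ∷ xs) ys = trans (cong (_+_ (f x)) (sumℤ-map-++ f xs ys)) (sym (ℤₚ.+-assoc (f x) _ _))

sumℤ-map-∘ : {A B : Set} (f : B → ℤ) (g : A → B) (xs : List A) →
  sumℤ (map f (map g xs)) ≡ sumℤ (map (f ∘ g) xs)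
sumℤ-map-∘ f g xs = cong sumℤ (sym (Listₚ.map-∘ xs))

sumℤ-map-cong : {A : Set} {f g : A → ℤ} (xs : List A) → (∀ a → f a ≡ g a) → sumℤ (map f xs) ≡ sumℤ (map g xs)
sumℤ-map-cong xs f≗g = cong sumℤ (Listₚ.map-cong f≗g xs)

sumℤ-map-zero : {A : Set} (f : A → ℤ) (xs : List A) → (∀ a → f a ≡ + 0) → sumℤ (map f xs) ≡ + 0
sumℤ-map-zero f [] _ = refl
sumℤ-map-zero f (x ∷ xs) f≗0 = cong₂ _+_ (f≗0 x) (sumℤ-map-zero f xs f≗0)

length-filterᵇ : {A : Set} (P : A → Bool) (xs : List A) → + length (filterᵇ P xs) ≡ sumℤ (map (𝟙 ∘ P) xs)
length-filterᵇ P [] = refl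
length-filterᵇ P (x ∷ xs) with P x
... | true = cong (_+_ (+ 1)) (length-filterᵇ P xs)
... | false = trans (length-filterᵇ P xs) (sym (ℤₚ.+-identityˡ _))

sumSubsets : (n : ℕ) → (Vec Bool n → ℤ) → ℤ
sumSubsets zero f = f []
sumSubsets (suc n) f = sumSubsets n (f ∘ (true ∷_)) + sumSubsets n (f ∘ (false ∷_))

sumSubsets-cong : ∀ n {f g : Vec Bool n → ℤ} → (∀ S → f S ≡ g S) → sumSubsets n f ≡ sumSubsets n g
sumSubsets-cong zero f≗g = f≗g []
sumSubsets-cong (suc n) f≗g = cong₂ _+_ (sumSubsets-cong n (f≗g ∘ (true ∷_))) (sumSubsets-cong n (f≗g ∘ (false ∷_)))

sumSubsets-+ : ∀ n (f g : Vec Bool n → ℤ) → sumSubsets n (λ S → f S + g S) ≡ sumSubsets n f + sumSubsets n g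
sumSubsets-+ zero f g = refl
sumSubsets-+ (suc n) f g = trans
  (cong₂ _+_ (sumSubsets-+ n (f ∘ (true ∷_)) (g ∘ (true ∷_))) (sumSubsets-+ n (f ∘ (false ∷_)) (g ∘ (false ∷_))))
  (interchange (sumSubsets n (f ∘ (true ∷_))) (sumSubsets n (g ∘ (true ∷_)))
               (sumSubsets n (f ∘ (false ∷_))) (sumSubsets n (g ∘ (false ∷_))))

sumSubsets-zero : ∀ n (f : Vec Bool n → ℤ) → (∀ S → f S ≡ + 0) → sumSubsets n f ≡ + 0
sumSubsets-zero zero f f≗0 = f≗0 []
sumSubsets-zero (suc n) f f≗0 =
  cong₂ _+_ (sumSubsets-zero n _ (f≗0 ∘ (true ∷_))) (sumSubsets-zero n _ (f≗0 ∘ (false ∷_)))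

sumSubsets-*ˡ : ∀ n c (f : Vec Bool n → ℤ) → c * sumSubsets n f ≡ sumSubsets n (λ S → c * f S)
sumSubsets-*ˡ zero c f = refl
sumSubsets-*ˡ (suc n) c f = trans (ℤₚ.*-distribˡ-+ c _ _) (cong₂ _+_ (sumSubsets-*ˡ n c _) (sumSubsets-*ˡ n c _))

sumSubsets-neg : ∀ n (f : Vec Bool n → ℤ) → sumSubsets n (λ S → - f S) ≡ - sumSubsets n f
sumSubsets-neg zero f = refl
sumSubsets-neg (suc n) f = trans
  (cong₂ _+_ (sumSubsets-neg n (f ∘ (true ∷_))) (sumSubsets-neg n (f ∘ (false ∷_))))
  (sym (ℤₚ.neg-distrib-+ (sumSubsets n (f ∘ (true ∷_))) (sumSubsets n (f ∘ (false ∷_)))))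

sumSubsets-swap : ∀ n m (f : Vec Bool n → Vec Bool m → ℤ) →
  sumSubsets n (λ S → sumSubsets m (f S)) ≡ sumSubsets m (λ T → sumSubsets n (λ S → f S T))
sumSubsets-swap zero m f = refl
sumSubsets-swap (suc n) m f = trans
  (cong₂ _+_ (sumSubsets-swap n m (f ∘ (true ∷_))) (sumSubsets-swap n m (f ∘ (false ∷_))))
  (sym (sumSubsets-+ m (λ T → sumSubsets n (λ S → f (true ∷ S) T)) (λ T → sumSubsets n (λ S → f (false ∷ S) T))))

sumℤ-map-sumSubsets : {A : Set} (n : ℕ) (f : A → Vec Bool n → ℤ) (xs : List A) →
  sumℤ (map (λ a → sumSubsets n (f a)) xs) ≡ sumSubsets n (λ S → sumℤ (map (λ a → f a S) xs))
sumℤ-map-sumSubsets n f [] = sym (sumSubsets-zero n _ (λ _ → refl))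
sumℤ-map-sumSubsets n f (x ∷ xs) = trans
  (cong (_+_ (sumSubsets n (f x))) (sumℤ-map-sumSubsets n f xs))
  (sym (sumSubsets-+ n (f x) (λ S → sumℤ (map (λ a → f a S) xs))))

sumSubsets-single : ∀ n (f : Vec Bool n → ℤ) W → (∀ S → S ≢ W → f S ≡ + 0) → sumSubsets n f ≡ f W
sumSubsets-single zero f [] _ = refl
sumSubsets-single (suc n) f (true ∷ W) f≗0 = trans
  (cong₂ _+_ (sumSubsets-single n _ W (λ S S≢W → f≗0 (true ∷ S) (S≢W ∘ cong Vec.tail)))
             (sumSubsets-zero n _ (λ S → f≗0 (false ∷ S) λ ())))
  (ℤₚ.+-identityʳ _)
sumSubsets-single (suc n) f (false ∷ W) f≗0 = trans
  (cong₂ _+_ (sumSubsets-zero n _ (λ S → f≗0 (true ∷ S) λ ()))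
             (sumSubsets-single n _ W (λ S S≢W → f≗0 (false ∷ S) (S≢W ∘ cong Vec.tail))))
  (ℤₚ.+-identityˡ _)

sumℤ-vecsOf-Bool : ∀ n (f : Vec Bool n → ℤ) → sumℤ (map f (vecsOf (true ∷ false ∷ []) n)) ≡ sumSubsets n f
sumℤ-vecsOf-Bool zero f = ℤₚ.+-identityʳ _
sumℤ-vecsOf-Bool (suc n) f = begin
  sumℤ (map f (map (true ∷_) V ++ map (false ∷_) V ++ []))
    ≡⟨ sumℤ-map-++ f (map (true ∷_) V) (map (false ∷_) V ++ []) ⟩
  sumℤ (map f (map (true ∷_) V)) + sumℤ (map f (map (false ∷_) V ++ []))
    ≡⟨ cong (λ W → sumℤ (map f (map (true ∷_) V)) + sumℤ (map f W)) (Listₚ.++-identityʳ (map (false ∷_) V)) ⟩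
  sumℤ (map f (map (true ∷_) V)) + sumℤ (map f (map (false ∷_) V))
    ≡⟨ cong₂ _+_ (trans (sumℤ-map-∘ f (true ∷_) V) (sumℤ-vecsOf-Bool n _))
                 (trans (sumℤ-map-∘ f (false ∷_) V) (sumℤ-vecsOf-Bool n _)) ⟩
  sumSubsets (suc n) f ∎
  where
  open ≡-Reasoning
  V = vecsOf (true ∷ false ∷ []) n

occ≡sumSubsets : (p : Mesh) {n : ℕ} (τ : Perm n) → + occ p τ ≡ sumSubsets n (𝟙 ∘ isOcc p τ)
occ≡sumSubsets p {n} τ =
  trans (length-filterᵇ (isOcc p τ) (vecsOf (true ∷ false ∷ []) n)) (sumℤ-vecsOf-Bool n (𝟙 ∘ isOcc p τ))

module ℕSum = MonoidSum ℕₚ.+-0-commutativeMonoid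

𝟙ℕ : Bool → ℕ
𝟙ℕ true = 1
𝟙ℕ false = 0

size : {n : ℕ} → Vec Bool n → ℕ
size [] = 0
size (b ∷ W) = 𝟙ℕ b ℕ.+ size W

rank : {n : ℕ} → Vec Bool n → ℕ → ℕ
rank [] _ = 0
rank (b ∷ W) zero = 0
rank (b ∷ W) (suc a) = 𝟙ℕ b ℕ.+ rank W a

countFin : (k : ℕ) → (Fin k → Bool) → ℕ
countFin k P = ℕSum.sum (𝟙ℕ ∘ P)

countFin-cong : ∀ k {P Q : Fin k → Bool} → (∀ i → P i ≡ Q i) → countFin k P ≡ countFin k Q
countFin-cong zero _ = refl
countFin-cong (suc k) P≗Q = cong₂ ℕ._+_ (cong 𝟙ℕ (P≗Q zero)) (countFin-cong k (P≗Q ∘ suc))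

countFin-+ : ∀ k (P Q R : Fin k → Bool) → (∀ i → 𝟙ℕ (P i) ≡ 𝟙ℕ (Q i) ℕ.+ 𝟙ℕ (R i)) →
  countFin k P ≡ countFin k Q ℕ.+ countFin k R
countFin-+ zero P Q R _ = refl
countFin-+ (suc k) P Q R P≗Q+R = trans
  (cong₂ ℕ._+_ (P≗Q+R zero) (countFin-+ k (P ∘ suc) (Q ∘ suc) (R ∘ suc) (P≗Q+R ∘ suc)))
  (ℕ-interchange (𝟙ℕ (Q zero)) (𝟙ℕ (R zero)) (countFin k (Q ∘ suc)) (countFin k (R ∘ suc)))

countFin-none : ∀ k (P : Fin k → Bool) → (∀ i → P i ≢ true) → countFin k P ≡ 0
countFin-none zero P _ = refl
countFin-none (suc k) P ¬P rewrite ≢true⇒≡false (¬P zero) = countFin-none k (P ∘ suc) (¬P ∘ suc)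

countFin-≤ : ∀ k (P : Fin k → Bool) → countFin k P ≤ k
countFin-≤ zero P = z≤n
countFin-≤ (suc k) P with P zero
... | true = s≤s (countFin-≤ k (P ∘ suc))
... | false = ℕₚ.m≤n⇒m≤1+n (countFin-≤ k (P ∘ suc))

countFin-prefix : ∀ k j (P : Fin k → Bool) → j ≤ k →
  (∀ i → P i ≡ true → toℕ i < j) → (∀ i → toℕ i < j → P i ≡ true) → countFin k P ≡ j
countFin-prefix zero zero P _ _ _ = refl
countFin-prefix (suc k) zero P _ P⇒< _ =
  countFin-none (suc k) P (λ i → ℕₚ.n≮0 ∘ P⇒< i)
countFin-prefix (suc k) (suc j) P (s≤s j≤k) P⇒< <⇒P rewrite <⇒P zero z<s =
  cong suc (countFin-prefix k j (P ∘ suc) j≤k (λ i Pi → ℕ.s<s⁻¹ (P⇒< (suc i) Pi)) (λ i i<j → <⇒P (suc i) (s<s i<j)))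

countFin-single : ∀ k (P : Fin k → Bool) i₀ → (∀ i → P i ≡ true → i ≡ i₀) → P i₀ ≡ true → countFin k P ≡ 1
countFin-single (suc k) P zero P⇒≡ Pi₀ rewrite Pi₀ =
  cong suc (countFin-none k (P ∘ suc) (λ i → Finₚ.0≢1+n ∘ sym ∘ P⇒≡ (suc i)))
countFin-single (suc k) P (suc i₀) P⇒≡ Pi₀ with P zero in eq
... | true with () ← P⇒≡ zero eq
... | false = countFin-single k (P ∘ suc) i₀ (λ i Pi → Finₚ.suc-injective (P⇒≡ (suc i) Pi)) Pi₀

DownClosed : ∀ {k} → (Fin k → Bool) → Set
DownClosed P = ∀ i l → toℕ l ≤ toℕ i → P i ≡ true → P l ≡ true

DownClosed-suc : ∀ {k} {P : Fin (suc k) → Bool} → DownClosed P → DownClosed (P ∘ suc)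
DownClosed-suc dc i l l≤i = dc (suc i) (suc l) (s≤s l≤i)

downClosed⇒<countFin : ∀ k (P : Fin k → Bool) → DownClosed P → ∀ i → P i ≡ true → toℕ i < countFin k P
downClosed⇒<countFin (suc k) P dc i Pi with P zero in eq
downClosed⇒<countFin (suc k) P dc zero Pi | true = z<s
downClosed⇒<countFin (suc k) P dc (suc i) Pi | true = s<s (downClosed⇒<countFin k (P ∘ suc) (DownClosed-suc dc) i Pi)
... | false = ⊥-elim (true≢false (dc i zero z≤n Pi) eq)

<countFin⇒downClosed : ∀ k (P : Fin k → Bool) → DownClosed P → ∀ i → toℕ i < countFin k P → P i ≡ true
<countFin⇒downClosed (suc k) P dc i i< with P zero in eq
<countFin⇒downClosed (suc k) P dc zero i< | true = eq
<countFin⇒downClosed (suc k) P dc (suc i) i< | true =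
  <countFin⇒downClosed k (P ∘ suc) (DownClosed-suc dc) i (ℕ.s<s⁻¹ i<)
... | false = ⊥-elim (ℕₚ.n≮0 (subst (toℕ i <_) count≡0 i<))
  where
  count≡0 : countFin k (P ∘ suc) ≡ 0
  count≡0 = countFin-none k (P ∘ suc) (λ j Pj → true≢false (dc (suc j) zero z≤n Pj) eq)

rank-zero : ∀ {n} (W : Vec Bool n) → rank W 0 ≡ 0
rank-zero [] = refl
rank-zero (b ∷ W) = refl

rank-suc : ∀ {n} (W : Vec Bool n) a (a<n : a < n) → rank W (suc a) ≡ rank W a ℕ.+ 𝟙ℕ (lookup W (fromℕ< a<n))
rank-suc (b ∷ W) zero _ rewrite rank-zero W = ℕₚ.+-identityʳ (𝟙ℕ b)
rank-suc (b ∷ W) (suc a) a<n =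
  trans (cong (𝟙ℕ b ℕ.+_) (rank-suc W a (ℕ.s<s⁻¹ a<n))) (sym (ℕₚ.+-assoc (𝟙ℕ b) _ _))

rank-full : ∀ {n} (W : Vec Bool n) a → n ≤ a → rank W a ≡ size W
rank-full [] a _ = refl
rank-full (b ∷ W) (suc a) (s≤s n≤a) = cong (𝟙ℕ b ℕ.+_) (rank-full W a n≤a)

rank-mono : ∀ {n} (W : Vec Bool n) {a b} → a ≤ b → rank W a ≤ rank W b
rank-mono [] _ = z≤n
rank-mono (x ∷ W) {zero} _ = z≤n
rank-mono (x ∷ W) {suc a} {suc b} (s≤s a≤b) = ℕₚ.+-monoʳ-≤ (𝟙ℕ x) (rank-mono W a≤b)

rank-<⁻¹ : ∀ {n} (W : Vec Bool n) {a b} → rank W a < rank W b → a < b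
rank-<⁻¹ W {a} {b} r< with a ℕ.<? b
... | yes a<b = a<b
... | no a≮b = ⊥-elim (ℕₚ.<⇒≱ r< (rank-mono W (ℕₚ.≮⇒≥ a≮b)))

rank-<-size : ∀ {n} (W : Vec Bool n) v → lookup W v ≡ true → rank W (toℕ v) < size W
rank-<-size (true ∷ W) zero _ = z<s
rank-<-size (b ∷ W) (suc v) Wv = ℕₚ.+-monoʳ-< (𝟙ℕ b) (rank-<-size W v Wv)

rank-strict : ∀ {n} (W : Vec Bool n) v {b} → lookup W v ≡ true → toℕ v < b → rank W (toℕ v) < rank W b
rank-strict W v {b} Wv v<b = ℕₚ.<-≤-trans r<r+1 (rank-mono W v<b)
  where
  r<r+1 : rank W (toℕ v) < rank W (suc (toℕ v))
  r<r+1 rewrite rank-suc W (toℕ v) (Finₚ.toℕ<n v) | Finₚ.fromℕ<-toℕ v (Finₚ.toℕ<n v) | Wv =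
    ℕₚ.m<m+n (rank W (toℕ v)) z<s

rank-injective : ∀ {n} (W : Vec Bool n) a b → lookup W a ≡ true → lookup W b ≡ true →
  rank W (toℕ a) ≡ rank W (toℕ b) → a ≡ b
rank-injective W a b Wa Wb r≡ with ℕₚ.<-cmp (toℕ a) (toℕ b)
... | tri< a<b _ _ = ⊥-elim (ℕₚ.<-irrefl r≡ (rank-strict W a Wa a<b))
... | tri≈ _ a≡b _ = Finₚ.toℕ-injective a≡b
... | tri> _ _ b<a = ⊥-elim (ℕₚ.<-irrefl (sym r≡) (rank-strict W b Wb b<a))

size≤length : ∀ {n} (S : Vec Bool n) → size S ≤ n
size≤length [] = z≤n
size≤length (true ∷ S) = s≤s (size≤length S)
size≤length (false ∷ S) = ℕₚ.m≤n⇒m≤1+n (size≤length S)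

𝟙ℕ-<ᵇ-suc : ∀ x a → 𝟙ℕ (x <ᵇ suc a) ≡ 𝟙ℕ (x <ᵇ a) ℕ.+ 𝟙ℕ (x ≡ᵇ a)
𝟙ℕ-<ᵇ-suc zero zero = refl
𝟙ℕ-<ᵇ-suc zero (suc a) = refl
𝟙ℕ-<ᵇ-suc (suc x) zero = refl
𝟙ℕ-<ᵇ-suc (suc x) (suc a) = 𝟙ℕ-<ᵇ-suc x a

at-map : ∀ {A : Set} {k} d (f : A → ℕ) (γ : Vec A k) (i : Fin k) → at d (map f (Vec.toList γ)) (toℕ i) ≡ f (lookup γ i)
at-map d f (a ∷ γ) zero = refl
at-map d f (a ∷ γ) (suc i) = at-map d f γ i

at-length : ∀ {A : Set} {k} d (f : A → ℕ) (γ : Vec A k) → at d (map f (Vec.toList γ)) k ≡ d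
at-length d f [] = refl
at-length d f (a ∷ γ) = at-length d f γ

ext-suc : ∀ {n k} (γ : Vec (Fin n) k) j (j<k : j < k) → ext γ (suc j) ≡ suc (toℕ (lookup γ (fromℕ< j<k)))
ext-suc {n} γ j j<k =
  subst (λ x → ext γ (suc x) ≡ suc (toℕ (lookup γ (fromℕ< j<k)))) (Finₚ.toℕ-fromℕ< j<k)
        (at-map (suc n) (suc ∘ toℕ) γ (fromℕ< j<k))

ext-last : ∀ {n k} (γ : Vec (Fin n) k) → ext γ (suc k) ≡ suc n
ext-last {n} γ = at-length (suc n) (suc ∘ toℕ) γ

record Enumerates {n k : ℕ} (γ : Vec (Fin n) k) (W : Vec Bool n) : Set where
  field
    mono : ∀ i j → toℕ i < toℕ j → toℕ (lookup γ i) < toℕ (lookup γ j)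
    marked : ∀ i → lookup W (lookup γ i) ≡ true
    onto : ∀ v → lookup W v ≡ true → ∃ λ i → lookup γ i ≡ v

-- ext is 1-based with ext γ 0 = 0 and ext γ (k + 1) = n + 1, so the gaps are numbered 0, …, k.
InGap : ∀ {n k} → Vec (Fin n) k → Fin n → ℕ → Set
InGap γ v i = ext γ i < suc (toℕ v) × suc (toℕ v) < ext γ (suc i)

module EnumeratesProperties {n k : ℕ} {γ : Vec (Fin n) k} {W : Vec Bool n} (E : Enumerates γ W) where
  open Enumerates E

  entry : Fin k → ℕ
  entry i = toℕ (lookup γ i)

  entry-mono-≤ : ∀ i j → toℕ i ≤ toℕ j → entry i ≤ entry j
  entry-mono-≤ i j i≤j with ℕₚ.m≤n⇒m<n∨m≡n i≤j
  ... | inj₁ i<j = ℕₚ.<⇒≤ (mono i j i<j)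
  ... | inj₂ i≡j rewrite Finₚ.toℕ-injective {i = i} {j = j} i≡j = ℕₚ.≤-refl

  entry-cancel-< : ∀ i j → entry i < entry j → toℕ i < toℕ j
  entry-cancel-< i j e< with toℕ i ℕ.<? toℕ j
  ... | yes i<j = i<j
  ... | no i≮j = ⊥-elim (ℕₚ.<⇒≱ e< (entry-mono-≤ j i (ℕₚ.≮⇒≥ i≮j)))

  lookup-injective : ∀ i j → lookup γ i ≡ lookup γ j → i ≡ j
  lookup-injective i j γi≡γj with ℕₚ.<-cmp (toℕ i) (toℕ j)
  ... | tri< i<j _ _ = ⊥-elim (ℕₚ.<-irrefl (cong toℕ γi≡γj) (mono i j i<j))
  ... | tri≈ _ i≡j _ = Finₚ.toℕ-injective i≡j
  ... | tri> _ _ j<i = ⊥-elim (ℕₚ.<-irrefl (cong toℕ (sym γi≡γj)) (mono j i j<i))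

  rank≡countEntriesBelow : ∀ a → a ≤ n → rank W a ≡ countFin k (λ l → entry l <ᵇ a)
  rank≡countEntriesBelow zero _ = trans (rank-zero W) (sym (countFin-none k _ (λ _ ())))
  rank≡countEntriesBelow (suc a) a<n = begin
    rank W (suc a)
      ≡⟨ rank-suc W a a<n ⟩
    rank W a ℕ.+ 𝟙ℕ (lookup W (fromℕ< a<n))
      ≡⟨ cong₂ ℕ._+_ (rank≡countEntriesBelow a (ℕₚ.<⇒≤ a<n)) marked-a ⟩
    countFin k (λ l → entry l <ᵇ a) ℕ.+ countFin k (λ l → entry l ≡ᵇ a)
      ≡⟨ countFin-+ k _ _ _ (λ l → 𝟙ℕ-<ᵇ-suc (entry l) a) ⟨
    countFin k (λ l → entry l <ᵇ suc a) ∎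
    where
    open ≡-Reasoning
    v = fromℕ< a<n
    entry≡a⇒ : ∀ l → (entry l ≡ᵇ a) ≡ true → lookup γ l ≡ v
    entry≡a⇒ l h = Finₚ.toℕ-injective (trans (≡ᵇ-elim h) (sym (Finₚ.toℕ-fromℕ< a<n)))
    marked-a : 𝟙ℕ (lookup W v) ≡ countFin k (λ l → entry l ≡ᵇ a)
    marked-a with lookup W v in Wv
    ... | true with onto v Wv
    ... | i₀ , γi₀≡v = sym (countFin-single k _ i₀
            (λ i h → lookup-injective i i₀ (trans (entry≡a⇒ i h) (sym γi₀≡v)))
            (≡ᵇ-intro (trans (cong toℕ γi₀≡v) (Finₚ.toℕ-fromℕ< a<n))))
    marked-a | false = sym (countFin-none k _
            (λ l h → true≢false (subst (λ x → lookup W x ≡ true) (entry≡a⇒ l h) (marked l)) Wv))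

  rank-entry : ∀ l → rank W (entry l) ≡ toℕ l
  rank-entry l = trans (rank≡countEntriesBelow _ (ℕₚ.<⇒≤ (Finₚ.toℕ<n (lookup γ l))))
    (countFin-prefix k (toℕ l) _ (ℕₚ.<⇒≤ (Finₚ.toℕ<n l))
      (λ i h → entry-cancel-< i l (<ᵇ-elim h)) (λ i i<l → <ᵇ-intro (mono i l i<l)))

  size≡length : size W ≡ k
  size≡length = begin
    size W                                ≡⟨ rank-full W n ℕₚ.≤-refl ⟨
    rank W n                              ≡⟨ rank≡countEntriesBelow n ℕₚ.≤-refl ⟩
    countFin k (λ l → entry l <ᵇ n)       ≡⟨ countFin-prefix k k _ ℕₚ.≤-refl (λ i _ → Finₚ.toℕ<n i)
                                               (λ i _ → <ᵇ-intro (Finₚ.toℕ<n (lookup γ i))) ⟩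
    k                                     ∎
    where open ≡-Reasoning

  module _ (v : Fin n) where
    private
      EntryBelow : Fin k → Bool
      EntryBelow l = entry l <ᵇ toℕ v

      EntryBelow-downClosed : DownClosed EntryBelow
      EntryBelow-downClosed i l l≤i h = <ᵇ-intro (ℕₚ.≤-<-trans (entry-mono-≤ l i l≤i) (<ᵇ-elim {entry i} {toℕ v} h))

      rank≡countEntryBelow : rank W (toℕ v) ≡ countFin k EntryBelow
      rank≡countEntryBelow = rank≡countEntriesBelow (toℕ v) (ℕₚ.<⇒≤ (Finₚ.toℕ<n v))

      gap-lower : ∀ j → j ≡ countFin k EntryBelow → ext γ j < suc (toℕ v)
      gap-lower zero _ = s≤s z≤n
      gap-lower (suc j) j≡ = subst (_< suc (toℕ v)) (sym (ext-suc γ j j<k)) (s<s (<ᵇ-elim below))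
        where
        j<k : j < k
        j<k = ℕₚ.≤-trans (ℕₚ.≤-reflexive j≡) (countFin-≤ k EntryBelow)
        below : EntryBelow (fromℕ< j<k) ≡ true
        below = <countFin⇒downClosed k EntryBelow EntryBelow-downClosed (fromℕ< j<k)
                  (subst (_< countFin k EntryBelow) (sym (Finₚ.toℕ-fromℕ< j<k)) (ℕₚ.≤-reflexive j≡))

      gap-upper : lookup W v ≡ false → ∀ j → j ≡ countFin k EntryBelow → suc (toℕ v) < ext γ (suc j)
      gap-upper Wv j j≡ with ℕₚ.m≤n⇒m<n∨m≡n (subst (_≤ k) (sym j≡) (countFin-≤ k EntryBelow))
      ... | inj₂ refl = subst (suc (toℕ v) <_) (sym (ext-last γ)) (s<s (Finₚ.toℕ<n v))
      ... | inj₁ j<k = subst (suc (toℕ v) <_) (sym (ext-suc γ j j<k)) (s<s v<entry)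
        where
        l = fromℕ< j<k
        ¬below : ¬ (EntryBelow l ≡ true)
        ¬below h = ℕₚ.<-irrefl (trans (Finₚ.toℕ-fromℕ< j<k) j≡)
                               (downClosed⇒<countFin k EntryBelow EntryBelow-downClosed l h)
        v≢entry : toℕ v ≢ entry l
        v≢entry v≡ = true≢false (subst (λ x → lookup W x ≡ true) (Finₚ.toℕ-injective (sym v≡)) (marked l)) Wv
        v<entry : toℕ v < entry l
        v<entry = ℕₚ.≤∧≢⇒< (ℕₚ.≮⇒≥ (¬below ∘ <ᵇ-intro)) v≢entry

      entries-below-gap : ∀ i → i ≤ k → ext γ i < suc (toℕ v) → ∀ l → toℕ l < i → entry l < toℕ v
      entries-below-gap (suc i) i<k lower l l<i =
        ℕₚ.≤-<-trans (entry-mono-≤ l (fromℕ< i<k′)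
                       (subst (toℕ l ≤_) (sym (Finₚ.toℕ-fromℕ< i<k′)) (ℕ.s≤s⁻¹ l<i)))
                     (ℕ.s<s⁻¹ (subst (_< suc (toℕ v)) (ext-suc γ i i<k′) lower))
        where
        i<k′ : i < k
        i<k′ = ℕₚ.<-≤-trans (ℕₚ.n<1+n i) i<k

      entries-above-gap : ∀ i → suc (toℕ v) < ext γ (suc i) → ∀ l → i ≤ toℕ l → toℕ v < entry l
      entries-above-gap i upper l i≤l =
        ℕₚ.<-≤-trans (ℕ.s<s⁻¹ (subst (suc (toℕ v) <_) (ext-suc γ i i<k) upper))
                     (entry-mono-≤ (fromℕ< i<k) l (subst (_≤ toℕ l) (sym (Finₚ.toℕ-fromℕ< i<k)) i≤l))
        where
        i<k : i < k
        i<k = ℕₚ.≤-<-trans i≤l (Finₚ.toℕ<n l)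

    unmarked⇒inGap : lookup W v ≡ false → rank W (toℕ v) ≤ k × InGap γ v (rank W (toℕ v))
    unmarked⇒inGap Wv =
      subst (_≤ k) (sym rank≡countEntryBelow) (countFin-≤ k EntryBelow) ,
      gap-lower _ rank≡countEntryBelow , gap-upper Wv _ rank≡countEntryBelow

    inGap⇒unmarked : ∀ i → i ≤ k → InGap γ v i → lookup W v ≡ false × rank W (toℕ v) ≡ i
    inGap⇒unmarked i i≤k (lower , upper) = unmarked , trans rank≡countEntryBelow
      (countFin-prefix k i EntryBelow i≤k below⇒< (λ l l<i → <ᵇ-intro (entries-below-gap i i≤k lower l l<i)))
      where
      below⇒< : ∀ l → EntryBelow l ≡ true → toℕ l < i
      below⇒< l h with toℕ l ℕ.<? i
      ... | yes l<i = l<i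
      ... | no l≮i = ⊥-elim (ℕₚ.<-asym (<ᵇ-elim h) (entries-above-gap i upper l (ℕₚ.≮⇒≥ l≮i)))
      unmarked : lookup W v ≡ false
      unmarked with lookup W v in Wv
      ... | false = refl
      ... | true with onto v Wv
      ... | l , γl≡v with toℕ l ℕ.<? i
      ... | yes l<i = ⊥-elim (ℕₚ.<-irrefl (cong toℕ γl≡v) (entries-below-gap i i≤k lower l l<i))
      ... | no l≮i = ⊥-elim (ℕₚ.<-irrefl (cong toℕ (sym γl≡v)) (entries-above-gap i upper l (ℕₚ.≮⇒≥ l≮i)))

enumerate : {n : ℕ} (W : Vec Bool n) → Vec (Fin n) (size W)
enumerate [] = []
enumerate (true ∷ W) = zero ∷ Vec.map Fin.suc (enumerate W)
enumerate (false ∷ W) = Vec.map Fin.suc (enumerate W)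

enumerate-Enumerates : ∀ {n} (W : Vec Bool n) → Enumerates (enumerate W) W
enumerate-Enumerates [] = record { mono = λ () ; marked = λ () ; onto = λ () }
enumerate-Enumerates (true ∷ W) = record { mono = mono′ ; marked = marked′ ; onto = onto′ }
  where
  open Enumerates (enumerate-Enumerates W)
  mono′ : ∀ i j → toℕ i < toℕ j → toℕ (lookup (enumerate (true ∷ W)) i) < toℕ (lookup (enumerate (true ∷ W)) j)
  mono′ zero (suc j) _ rewrite Vecₚ.lookup-map j Fin.suc (enumerate W) = z<s
  mono′ (suc i) (suc j) i<j rewrite Vecₚ.lookup-map j Fin.suc (enumerate W) | Vecₚ.lookup-map i Fin.suc (enumerate W) =
    s<s (mono i j (ℕ.s<s⁻¹ i<j))
  marked′ : ∀ i → lookup (true ∷ W) (lookup (enumerate (true ∷ W)) i) ≡ true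
  marked′ zero = refl
  marked′ (suc i) rewrite Vecₚ.lookup-map i Fin.suc (enumerate W) = marked i
  onto′ : ∀ v → lookup (true ∷ W) v ≡ true → ∃ λ i → lookup (enumerate (true ∷ W)) i ≡ v
  onto′ zero _ = zero , refl
  onto′ (suc v) Wv with onto v Wv
  ... | i , γi≡v = suc i , trans (Vecₚ.lookup-map i Fin.suc (enumerate W)) (cong suc γi≡v)
enumerate-Enumerates (false ∷ W) = record { mono = mono′ ; marked = marked′ ; onto = onto′ }
  where
  open Enumerates (enumerate-Enumerates W)
  mono′ : ∀ i j → toℕ i < toℕ j → toℕ (lookup (enumerate (false ∷ W)) i) < toℕ (lookup (enumerate (false ∷ W)) j)
  mono′ i j i<j rewrite Vecₚ.lookup-map j Fin.suc (enumerate W) | Vecₚ.lookup-map i Fin.suc (enumerate W) = s<s (mono i j i<j)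
  marked′ : ∀ i → lookup (false ∷ W) (lookup (enumerate (false ∷ W)) i) ≡ true
  marked′ i rewrite Vecₚ.lookup-map i Fin.suc (enumerate W) = marked i
  onto′ : ∀ v → lookup (false ∷ W) v ≡ true → ∃ λ i → lookup (enumerate (false ∷ W)) i ≡ v
  onto′ (suc v) Wv with onto v Wv
  ... | i , γi≡v = i , trans (Vecₚ.lookup-map i Fin.suc (enumerate W)) (cong suc γi≡v)

⟨⟩-injective : ∀ {n} (τ : Perm n) (i j : Fin n) → τ ⟨ i ⟩ ≡ τ ⟨ j ⟩ → i ≡ j
⟨⟩-injective {n} (v , d) i j τi≡τj = =ᶠ-elim (⇒ᵇ-elim {lookup v i =ᶠ lookup v j}
  (allF-elim n (allF-elim n (T⇒≡true d) i) j) (=ᶠ-intro τi≡τj))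

injective⇒surjective : ∀ {n} (f : Fin n → Fin n) → (∀ i j → f i ≡ f j → i ≡ j) → ∀ v → ∃ λ x → f x ≡ v
injective⇒surjective {suc n} f f-inj v with Finₚ.any? (λ x → f x Finₚ.≟ v)
... | yes hit = hit
... | no miss with Finₚ.pigeonhole (ℕₚ.n<1+n n) (λ x → punchOut {i = v} {j = f x} (miss ∘ (x ,_) ∘ sym))
... | i , j , i<j , collide = ⊥-elim (Finₚ.<-irrefl (f-inj i j
  (Finₚ.punchOut-injective {i = v} (miss ∘ (i ,_) ∘ sym) (miss ∘ (j ,_) ∘ sym) collide)) i<j)

_⁻¹⟨_⟩ : ∀ {n} → Perm n → Fin n → Fin n
τ ⁻¹⟨ v ⟩ = proj₁ (injective⇒surjective (τ ⟨_⟩) (⟨⟩-injective τ) v)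

⟨⁻¹⟨⟩⟩ : ∀ {n} (τ : Perm n) v → τ ⟨ τ ⁻¹⟨ v ⟩ ⟩ ≡ v
⟨⁻¹⟨⟩⟩ τ v = proj₂ (injective⇒surjective (τ ⟨_⟩) (⟨⟩-injective τ) v)

⁻¹⟨⟨⟩⟩ : ∀ {n} (τ : Perm n) x → τ ⁻¹⟨ τ ⟨ x ⟩ ⟩ ≡ x
⁻¹⟨⟨⟩⟩ τ x = ⟨⟩-injective τ _ _ (⟨⁻¹⟨⟩⟩ τ (τ ⟨ x ⟩))

lookup-ext : ∀ {A : Set} {m} (v v′ : Vec A m) → (∀ i → lookup v i ≡ lookup v′ i) → v ≡ v′
lookup-ext v v′ v≗v′ = begin
  v                      ≡⟨ Vecₚ.tabulate∘lookup v ⟨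
  Vec.tabulate (lookup v)  ≡⟨ Vecₚ.tabulate-cong v≗v′ ⟩
  Vec.tabulate (lookup v′) ≡⟨ Vecₚ.tabulate∘lookup v′ ⟩
  v′                     ∎
  where open ≡-Reasoning

perm-≡ : ∀ {m} (σ σ′ : Perm m) → (∀ i → σ ⟨ i ⟩ ≡ σ′ ⟨ i ⟩) → σ ≡ σ′
perm-≡ (v , d) (v′ , d′) σ≗σ′ with lookup-ext v v′ σ≗σ′
... | refl = cong (v ,_) (T-irrelevant d d′)

countFin-permute : ∀ {n} (τ : Perm n) (P : Fin n → Bool) → countFin n (P ∘ τ ⁻¹⟨_⟩) ≡ countFin n P
countFin-permute τ P =
  sym (ℕSum.sum-permute (𝟙ℕ ∘ P) (permutation (τ ⁻¹⟨_⟩) (τ ⟨_⟩) (⁻¹⟨⟨⟩⟩ τ) (⟨⁻¹⟨⟩⟩ τ)))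

valueSet : ∀ {n} → Perm n → Vec Bool n → Vec Bool n
valueSet τ S = Vec.tabulate (lookup S ∘ τ ⁻¹⟨_⟩)

lookup-valueSet : ∀ {n} (τ : Perm n) (S : Vec Bool n) v → lookup (valueSet τ S) v ≡ lookup S (τ ⁻¹⟨ v ⟩)
lookup-valueSet τ S v = Vecₚ.lookup∘tabulate _ v

lookup-valueSet-⟨⟩ : ∀ {n} (τ : Perm n) (S : Vec Bool n) x → lookup (valueSet τ S) (τ ⟨ x ⟩) ≡ lookup S x
lookup-valueSet-⟨⟩ τ S x = trans (lookup-valueSet τ S _) (cong (lookup S) (⁻¹⟨⟨⟩⟩ τ x))

size≡countFin : ∀ {n} (W : Vec Bool n) → size W ≡ countFin n (lookup W)
size≡countFin [] = refl
size≡countFin (b ∷ W) = cong (𝟙ℕ b ℕ.+_) (size≡countFin W)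

size-valueSet : ∀ {n} (τ : Perm n) (S : Vec Bool n) → size (valueSet τ S) ≡ size S
size-valueSet {n} τ S = begin
  size (valueSet τ S)                ≡⟨ size≡countFin (valueSet τ S) ⟩
  countFin n (lookup (valueSet τ S)) ≡⟨ countFin-cong n (lookup-valueSet τ S) ⟩
  countFin n (lookup S ∘ τ ⁻¹⟨_⟩)    ≡⟨ countFin-permute τ (lookup S) ⟩
  countFin n (lookup S)              ≡⟨ size≡countFin S ⟨
  size S                             ∎
  where open ≡-Reasoning

-- Occurrences as point sets

-- Indices above k are clamped to k; only indices ≤ k are ever used.
clamp : ∀ {k} → ℕ → Fin (suc k)
clamp {k} i with i ℕ.<? suc k
... | yes i<1+k = fromℕ< i<1+k
... | no _ = fromℕ k

toℕ-clamp : ∀ {k} i → i ≤ k → toℕ (clamp {k} i) ≡ i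
toℕ-clamp {k} i i≤k with i ℕ.<? suc k
... | yes i<1+k = Finₚ.toℕ-fromℕ< i<1+k
... | no i≮1+k = ⊥-elim (i≮1+k (s≤s i≤k))

clamp-toℕ : ∀ {k} (i : Fin (suc k)) → clamp {k} (toℕ i) ≡ i
clamp-toℕ i = Finₚ.toℕ-injective (toℕ-clamp (toℕ i) (ℕ.s≤s⁻¹ (Finₚ.toℕ<n i)))

shaded : Mesh → ℕ → ℕ → Bool
shaded p i j = R p (clamp i) (clamp j)

permℕ : ∀ {m} → Perm m → ℕ → ℕ
permℕ σ = at 0 (map toℕ (Vec.toList (proj₁ σ)))

permℕ-toℕ : ∀ {m} (σ : Perm m) (i : Fin m) → permℕ σ (toℕ i) ≡ toℕ (σ ⟨ i ⟩)
permℕ-toℕ σ = at-map 0 toℕ (proj₁ σ)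

colRank : ∀ {n} → Vec Bool n → Fin n → ℕ
colRank S x = rank S (toℕ x)

rowRank : ∀ {n} → Perm n → Vec Bool n → Fin n → ℕ
rowRank τ S x = rank (valueSet τ S) (toℕ (τ ⟨ x ⟩))

-- A point x of τ outside S lies in the box (colRank S x , rowRank τ S x) of the mesh drawn through S, and the
-- point of S in column r must lie in row π(r).
formsPattern : ∀ {m} → Perm m → {n : ℕ} → Perm n → Vec Bool n → Bool
formsPattern σ {n} τ S = allF n (λ x → lookup S x ⇒ᵇ (permℕ σ (colRank S x) ≡ᵇ rowRank τ S x))

avoidsShading : Mesh → {n : ℕ} → Perm n → Vec Bool n → Bool
avoidsShading p {n} τ S = allF n (λ x → not (lookup S x) ⇒ᵇ not (shaded p (colRank S x) (rowRank τ S x)))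

isOccurrenceSet : (p : Mesh) {n : ℕ} → Perm n → Vec Bool n → Bool
isOccurrenceSet p τ S = (size S ≡ᵇ k p) ∧ (formsPattern (π p) τ S ∧ avoidsShading p τ S)

inBox : ∀ {n k} → Perm n → (α β : Vec (Fin n) k) → Fin n → ℕ → ℕ → Bool
inBox τ α β x i j =
  (ext α i <ᵇ suc (toℕ x) <ᵇ ext α (suc i)) ∧ (ext β j <ᵇ suc (toℕ (τ ⟨ x ⟩)) <ᵇ ext β (suc j))

inBox⇒InGap : ∀ {n k} (τ : Perm n) (α β : Vec (Fin n) k) x i j →
  inBox τ α β x i j ≡ true → InGap α x i × InGap β (τ ⟨ x ⟩) j
inBox⇒InGap τ α β x i j h with ∧-elim h
... | colᵇ , rowᵇ with ∧-elim colᵇ | ∧-elim rowᵇ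
... | col₁ , col₂ | row₁ , row₂ = (<ᵇ-elim col₁ , <ᵇ-elim col₂) , (<ᵇ-elim row₁ , <ᵇ-elim row₂)

InGap⇒inBox : ∀ {n k} (τ : Perm n) (α β : Vec (Fin n) k) x i j →
  InGap α x i → InGap β (τ ⟨ x ⟩) j → inBox τ α β x i j ≡ true
InGap⇒inBox τ α β x i j (col₁ , col₂) (row₁ , row₂) =
  ∧-intro (∧-intro (<ᵇ-intro col₁) (<ᵇ-intro col₂)) (∧-intro (<ᵇ-intro row₁) (<ᵇ-intro row₂))

record IsOccurrence (p : Mesh) {n : ℕ} (τ : Perm n) (S : Vec Bool n) (α β : Vec (Fin n) (k p)) : Set where
  field
    positions : Enumerates α S
    values : Enumerates β (valueSet τ S)
    matches : ∀ i → τ ⟨ lookup α i ⟩ ≡ lookup β (π p ⟨ i ⟩)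
    unshaded : ∀ i j x → R p i j ≡ true → inBox τ α β x (toℕ i) (toℕ j) ≡ false

increasing-elim : ∀ {n m} (α : Vec (Fin n) m) → increasing α ≡ true →
  ∀ i j → toℕ i < toℕ j → toℕ (lookup α i) < toℕ (lookup α j)
increasing-elim {m = m} α h i j i<j =
  <ᵇ-elim (⇒ᵇ-elim {toℕ i <ᵇ toℕ j} (allF-elim m (allF-elim m h i) j) (<ᵇ-intro i<j))

increasing-intro : ∀ {n m} (α : Vec (Fin n) m) →
  (∀ i j → toℕ i < toℕ j → toℕ (lookup α i) < toℕ (lookup α j)) → increasing α ≡ true
increasing-intro {m = m} α mono =
  allF-intro m λ i → allF-intro m λ j → ⇒ᵇ-intro λ i<j → <ᵇ-intro (mono i j (<ᵇ-elim i<j))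

∧₅-elim : ∀ a b c d e → a ∧ (b ∧ (c ∧ (d ∧ e))) ≡ true →
  a ≡ true × b ≡ true × c ≡ true × d ≡ true × e ≡ true
∧₅-elim true true true true true _ = refl , refl , refl , refl , refl

∧₅-intro : ∀ {a b c d e} → a ≡ true → b ≡ true → c ≡ true → d ≡ true → e ≡ true →
  a ∧ (b ∧ (c ∧ (d ∧ e))) ≡ true
∧₅-intro refl refl refl refl refl = refl

module _ (p : Mesh) {n : ℕ} (τ : Perm n) (S : Vec Bool n) (α β : Vec (Fin n) (k p)) where
  private
    K = k p

  isOccWith⇒IsOccurrence : isOccWith p τ S α β ≡ true → IsOccurrence p τ S α β
  isOccWith⇒IsOccurrence h = record
    { positions = positions ; values = values ; matches = matches ; unshaded = unshaded }
    where
    parts = ∧₅-elim _ _ _ _ _ h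
    α-incr = proj₁ parts
    β-incr = proj₁ (proj₂ parts)
    points = allF-elim K (proj₁ (proj₂ (proj₂ parts)))
    covered : ∀ x → lookup S x ≡ true →
      ∃ λ i → (lookup α i =ᶠ x) ∧ (lookup β (π p ⟨ i ⟩) =ᶠ τ ⟨ x ⟩) ≡ true
    covered x Sx = anyF-elim K (⇒ᵇ-elim {lookup S x} (allF-elim n (proj₁ (proj₂ (proj₂ (proj₂ parts)))) x) Sx)
    boxes = proj₂ (proj₂ (proj₂ (proj₂ parts)))
    positions : Enumerates α S
    positions = record
      { mono = increasing-elim α α-incr
      ; marked = λ i → ∧-elimˡ (points i)
      ; onto = λ x Sx → let (i , h) = covered x Sx in i , =ᶠ-elim (∧-elimˡ h) }
    matches : ∀ i → τ ⟨ lookup α i ⟩ ≡ lookup β (π p ⟨ i ⟩)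
    matches i = =ᶠ-elim (∧-elimʳ {lookup S (lookup α i)} (points i))
    values : Enumerates β (valueSet τ S)
    values = record { mono = increasing-elim β β-incr ; marked = marked ; onto = onto }
      where
      marked : ∀ l → lookup (valueSet τ S) (lookup β l) ≡ true
      marked l = subst (λ l′ → lookup (valueSet τ S) (lookup β l′) ≡ true) (⟨⁻¹⟨⟩⟩ (π p) l)
        (trans (cong (lookup (valueSet τ S)) (sym (matches (π p ⁻¹⟨ l ⟩))))
               (trans (lookup-valueSet-⟨⟩ τ S _) (Enumerates.marked positions _)))
      onto : ∀ v → lookup (valueSet τ S) v ≡ true → ∃ λ l → lookup β l ≡ v
      onto v Vv with covered (τ ⁻¹⟨ v ⟩) (trans (sym (lookup-valueSet τ S v)) Vv)
      ... | i , h = π p ⟨ i ⟩ , trans (=ᶠ-elim (∧-elimʳ {lookup α i =ᶠ τ ⁻¹⟨ v ⟩} h)) (⟨⁻¹⟨⟩⟩ τ v)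
    unshaded : ∀ i j x → R p i j ≡ true → inBox τ α β x (toℕ i) (toℕ j) ≡ false
    unshaded i j x Rij = not-≡true (allF-elim n (⇒ᵇ-elim {R p i j} (allF-elim (suc K) (allF-elim (suc K) boxes i) j) Rij) x)

  IsOccurrence⇒isOccWith : IsOccurrence p τ S α β → isOccWith p τ S α β ≡ true
  IsOccurrence⇒isOccWith occ = ∧₅-intro
    (increasing-intro α (Enumerates.mono positions)) (increasing-intro β (Enumerates.mono values))
    (allF-intro K λ i → ∧-intro (Enumerates.marked positions i) (=ᶠ-intro (matches i)))
    (allF-intro n λ x → ⇒ᵇ-intro λ Sx → let (i , αi≡x) = Enumerates.onto positions x Sx in
      anyF-intro K i (∧-intro (=ᶠ-intro αi≡x) (=ᶠ-intro (trans (sym (matches i)) (cong (τ ⟨_⟩) αi≡x)))))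
    (allF-intro (suc K) λ i → allF-intro (suc K) λ j → ⇒ᵇ-intro λ Rij → allF-intro n λ x →
      not-≡false (unshaded i j x Rij))
    where open IsOccurrence occ

module _ {p : Mesh} {n : ℕ} {τ : Perm n} {S : Vec Bool n} {α β : Vec (Fin n) (k p)}
         (occ : IsOccurrence p τ S α β) where
  open IsOccurrence occ
  private
    module Pos = EnumeratesProperties positions
    module Val = EnumeratesProperties values

  IsOccurrence⇒formsPattern : ∀ x → lookup S x ≡ true → permℕ (π p) (colRank S x) ≡ rowRank τ S x
  IsOccurrence⇒formsPattern x Sx with Enumerates.onto positions x Sx
  ... | i , refl = begin
    permℕ (π p) (colRank S (lookup α i))               ≡⟨ cong (permℕ (π p)) (Pos.rank-entry i) ⟩
    permℕ (π p) (toℕ i)                                ≡⟨ permℕ-toℕ (π p) i ⟩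
    toℕ (π p ⟨ i ⟩)                                    ≡⟨ Val.rank-entry (π p ⟨ i ⟩) ⟨
    rank (valueSet τ S) (toℕ (lookup β (π p ⟨ i ⟩)))   ≡⟨ cong (rank (valueSet τ S) ∘ toℕ) (matches i) ⟨
    rowRank τ S (lookup α i)                           ∎
    where open ≡-Reasoning

  IsOccurrence⇒unshaded : ∀ x → lookup S x ≡ false → shaded p (colRank S x) (rowRank τ S x) ≡ false
  IsOccurrence⇒unshaded x Sx with Pos.unmarked⇒inGap x Sx
                              | Val.unmarked⇒inGap (τ ⟨ x ⟩) (trans (lookup-valueSet-⟨⟩ τ S x) Sx)
  ... | col≤k , colGap | row≤k , rowGap with shaded p (colRank S x) (rowRank τ S x) in shadedBox
  ... | false = refl
  ... | true = ⊥-elim (true≢false inside (unshaded i j x shadedBox))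
    where
    i = clamp {k p} (colRank S x)
    j = clamp {k p} (rowRank τ S x)
    inside : inBox τ α β x (toℕ i) (toℕ j) ≡ true
    inside rewrite toℕ-clamp {k p} (colRank S x) col≤k | toℕ-clamp {k p} (rowRank τ S x) row≤k =
      InGap⇒inBox τ α β x _ _ colGap rowGap

  IsOccurrence⇒isOccurrenceSet : isOccurrenceSet p τ S ≡ true
  IsOccurrence⇒isOccurrenceSet = ∧-intro (≡ᵇ-intro Pos.size≡length) (∧-intro
    (allF-intro n λ x → ⇒ᵇ-intro λ Sx → ≡ᵇ-intro (IsOccurrence⇒formsPattern x Sx))
    (allF-intro n λ x → ⇒ᵇ-intro λ ¬Sx → not-≡false (IsOccurrence⇒unshaded x (not-≡true ¬Sx))))

enumerationOfSize : ∀ {n k} (W : Vec Bool n) → size W ≡ k → Σ (Vec (Fin n) k) (λ γ → Enumerates γ W)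
enumerationOfSize W refl = enumerate W , enumerate-Enumerates W

module _ {p : Mesh} {n : ℕ} {τ : Perm n} {S : Vec Bool n} (occSet : isOccurrenceSet p τ S ≡ true) where
  private
    K = k p
    VS = valueSet τ S
    α = proj₁ (enumerationOfSize S (≡ᵇ-elim (∧-elimˡ occSet)))
    positions : Enumerates α S
    positions = proj₂ (enumerationOfSize S (≡ᵇ-elim (∧-elimˡ occSet)))
    module Pos = EnumeratesProperties positions
    pattern-holds : ∀ x → lookup S x ≡ true → permℕ (π p) (colRank S x) ≡ rowRank τ S x
    pattern-holds x Sx = ≡ᵇ-elim (⇒ᵇ-elim {lookup S x} (allF-elim n (∧-elimˡ (∧-elimʳ {size S ≡ᵇ K} occSet)) x) Sx)
    shading-avoided : ∀ x → lookup S x ≡ false → shaded p (colRank S x) (rowRank τ S x) ≡ false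
    shading-avoided x ¬Sx = not-≡true (⇒ᵇ-elim {not (lookup S x)}
      (allF-elim n (∧-elimʳ {formsPattern (π p) τ S} (∧-elimʳ {size S ≡ᵇ K} occSet)) x) (not-≡false ¬Sx))

    β : Vec (Fin n) K
    β = Vec.tabulate (λ l → τ ⟨ lookup α (π p ⁻¹⟨ l ⟩) ⟩)

    lookup-β : ∀ l → lookup β l ≡ τ ⟨ lookup α (π p ⁻¹⟨ l ⟩) ⟩
    lookup-β = Vecₚ.lookup∘tabulate _

    matches : ∀ i → τ ⟨ lookup α i ⟩ ≡ lookup β (π p ⟨ i ⟩)
    matches i = sym (trans (lookup-β _) (cong (λ z → τ ⟨ lookup α z ⟩) (⁻¹⟨⟨⟩⟩ (π p) i)))

    rowRank-entry : ∀ l → rowRank τ S (lookup α (π p ⁻¹⟨ l ⟩)) ≡ toℕ l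
    rowRank-entry l = begin
      rowRank τ S (lookup α i)             ≡⟨ pattern-holds _ (Enumerates.marked positions i) ⟨
      permℕ (π p) (colRank S (lookup α i)) ≡⟨ cong (permℕ (π p)) (Pos.rank-entry i) ⟩
      permℕ (π p) (toℕ i)                  ≡⟨ permℕ-toℕ (π p) i ⟩
      toℕ (π p ⟨ i ⟩)                      ≡⟨ cong toℕ (⟨⁻¹⟨⟩⟩ (π p) l) ⟩
      toℕ l                                ∎
      where
      open ≡-Reasoning
      i = π p ⁻¹⟨ l ⟩

    values : Enumerates β VS
    values = record { mono = mono ; marked = marked ; onto = onto }
      where
      mono : ∀ l l′ → toℕ l < toℕ l′ → toℕ (lookup β l) < toℕ (lookup β l′)
      mono l l′ l<l′ rewrite lookup-β l | lookup-β l′ =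
        rank-<⁻¹ VS (subst₂ _<_ (sym (rowRank-entry l)) (sym (rowRank-entry l′)) l<l′)
      marked : ∀ l → lookup VS (lookup β l) ≡ true
      marked l = trans (cong (lookup VS) (lookup-β l))
                       (trans (lookup-valueSet-⟨⟩ τ S _) (Enumerates.marked positions _))
      onto : ∀ v → lookup VS v ≡ true → ∃ λ l → lookup β l ≡ v
      onto v Vv with Enumerates.onto positions (τ ⁻¹⟨ v ⟩) (trans (sym (lookup-valueSet τ S v)) Vv)
      ... | i , αi≡ = π p ⟨ i ⟩ , trans (sym (matches i)) (trans (cong (τ ⟨_⟩) αi≡) (⟨⁻¹⟨⟩⟩ τ v))

    module Val = EnumeratesProperties values

    unshaded : ∀ i j x → R p i j ≡ true → inBox τ α β x (toℕ i) (toℕ j) ≡ false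
    unshaded i j x Rij = ≢true⇒≡false λ box →
      let colGap , rowGap = inBox⇒InGap τ α β x (toℕ i) (toℕ j) box
          ¬Sx , col≡i = Pos.inGap⇒unmarked x (toℕ i) (ℕ.s≤s⁻¹ (Finₚ.toℕ<n i)) colGap
          _ , row≡j = Val.inGap⇒unmarked (τ ⟨ x ⟩) (toℕ j) (ℕ.s≤s⁻¹ (Finₚ.toℕ<n j)) rowGap
      in true≢false Rij (begin
        R p i j                                ≡⟨ cong₂ (R p) (clamp-toℕ i) (clamp-toℕ j) ⟨
        R p (clamp (toℕ i)) (clamp (toℕ j))    ≡⟨ cong₂ (shaded p) col≡i row≡j ⟨
        shaded p (colRank S x) (rowRank τ S x) ≡⟨ shading-avoided x ¬Sx ⟩
        false                                  ∎)
      where open ≡-Reasoning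

  isOccurrenceSet⇒IsOccurrence : Σ (Vec (Fin n) K) λ α → Σ (Vec (Fin n) K) λ β → IsOccurrence p τ S α β
  isOccurrenceSet⇒IsOccurrence = α , β , record
    { positions = positions ; values = values ; matches = matches ; unshaded = unshaded }

isOcc≡isOccurrenceSet : (p : Mesh) {n : ℕ} (τ : Perm n) (S : Vec Bool n) → isOcc p τ S ≡ isOccurrenceSet p τ S
isOcc≡isOccurrenceSet p {n} τ S = bool-ext occ⇒set set⇒occ
  where
  vecs = vecsOf (allFin n) (k p)
  occ⇒set : isOcc p τ S ≡ true → isOccurrenceSet p τ S ≡ true
  occ⇒set h =
    let α , h′ = any-elim _ vecs h
        β , h″ = any-elim _ vecs h′
    in IsOccurrence⇒isOccurrenceSet (isOccWith⇒IsOccurrence p τ S α β h″)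
  set⇒occ : isOccurrenceSet p τ S ≡ true → isOcc p τ S ≡ true
  set⇒occ h =
    let α , β , occ = isOccurrenceSet⇒IsOccurrence h
    in any-vecsOf-intro n (k p) _ α (any-vecsOf-intro n (k p) _ β (IsOccurrence⇒isOccWith p τ S α β occ))

-- The pattern formed by a set of points, and classical occurrences

distinct-intro : ∀ {m} (v : Vec (Fin m) m) → (∀ i j → lookup v i ≡ lookup v j → i ≡ j) → T (distinct v)
distinct-intro {m} v v-inj = ≡true⇒T (allF-intro m λ i → allF-intro m λ j →
  ⇒ᵇ-intro λ vi≡vj → =ᶠ-intro (v-inj i j (=ᶠ-elim vi≡vj)))

module PatternOf {n : ℕ} (τ : Perm n) (S : Vec Bool n) where
  private
    E = enumerate-Enumerates S
    module Pos = EnumeratesProperties E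

    marked-value : ∀ i → lookup (valueSet τ S) (τ ⟨ lookup (enumerate S) i ⟩) ≡ true
    marked-value i = trans (lookup-valueSet-⟨⟩ τ S _) (Enumerates.marked E i)

    rowRank<size : ∀ i → rowRank τ S (lookup (enumerate S) i) < size S
    rowRank<size i = subst (rowRank τ S (lookup (enumerate S) i) <_) (size-valueSet τ S)
                           (rank-<-size (valueSet τ S) _ (marked-value i))

  patternVec : Vec (Fin (size S)) (size S)
  patternVec = Vec.tabulate (λ i → fromℕ< (rowRank<size i))

  toℕ-patternVec : ∀ i → toℕ (lookup patternVec i) ≡ rowRank τ S (lookup (enumerate S) i)
  toℕ-patternVec i = trans (cong toℕ (Vecₚ.lookup∘tabulate _ i)) (Finₚ.toℕ-fromℕ< (rowRank<size i))

  patternVec-injective : ∀ i j → lookup patternVec i ≡ lookup patternVec j → i ≡ j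
  patternVec-injective i j pi≡pj = Pos.lookup-injective i j (⟨⟩-injective τ _ _
    (rank-injective (valueSet τ S) _ _ (marked-value i) (marked-value j)
      (trans (sym (toℕ-patternVec i)) (trans (cong toℕ pi≡pj) (toℕ-patternVec j)))))

  patternOf : Perm (size S)
  patternOf = patternVec , distinct-intro patternVec patternVec-injective

open PatternOf using (patternOf)

module _ {n : ℕ} (τ : Perm n) (S : Vec Bool n) where
  private
    E = enumerate-Enumerates S
    module Pos = EnumeratesProperties E
    open PatternOf τ S using (toℕ-patternVec)

  isOccurrenceSet-patternOf : isOccurrenceSet (classical (patternOf τ S)) τ S ≡ true
  isOccurrenceSet-patternOf = ∧-intro (≡ᵇ-intro {size S} refl)
    (∧-intro (allF-intro n forms) (allF-intro n (λ _ → ⇒ᵇ-intro λ _ → refl)))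
    where
    forms : ∀ x → (lookup S x ⇒ᵇ (permℕ (patternOf τ S) (colRank S x) ≡ᵇ rowRank τ S x)) ≡ true
    forms x = ⇒ᵇ-intro λ Sx → let (i , γi≡x) = Enumerates.onto E x Sx in ≡ᵇ-intro (begin
      permℕ (patternOf τ S) (colRank S x)                ≡⟨ cong (permℕ (patternOf τ S) ∘ colRank S) γi≡x ⟨
      permℕ (patternOf τ S) (colRank S (lookup (enumerate S) i)) ≡⟨ cong (permℕ (patternOf τ S)) (Pos.rank-entry i) ⟩
      permℕ (patternOf τ S) (toℕ i)                      ≡⟨ permℕ-toℕ (patternOf τ S) i ⟩
      toℕ (patternOf τ S ⟨ i ⟩)                          ≡⟨ toℕ-patternVec i ⟩
      rowRank τ S (lookup (enumerate S) i)               ≡⟨ cong (rowRank τ S) γi≡x ⟩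
      rowRank τ S x                                      ∎)
      where open ≡-Reasoning

  isOccurrenceSet-classical⇒≡patternOf : (σ : Perm (size S)) →
    isOccurrenceSet (classical σ) τ S ≡ true → σ ≡ patternOf τ S
  isOccurrenceSet-classical⇒≡patternOf σ occSet = perm-≡ σ (patternOf τ S) λ i → Finₚ.toℕ-injective (begin
    toℕ (σ ⟨ i ⟩)                               ≡⟨ permℕ-toℕ σ i ⟨
    permℕ σ (toℕ i)                             ≡⟨ cong (permℕ σ) (Pos.rank-entry i) ⟨
    permℕ σ (colRank S (lookup (enumerate S) i)) ≡⟨ forms (lookup (enumerate S) i) (Enumerates.marked E i) ⟩
    rowRank τ S (lookup (enumerate S) i)        ≡⟨ toℕ-patternVec i ⟨
    toℕ (patternOf τ S ⟨ i ⟩)                   ∎)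
    where
    open ≡-Reasoning
    forms : ∀ x → lookup S x ≡ true → permℕ σ (colRank S x) ≡ rowRank τ S x
    forms x Sx = ≡ᵇ-elim (⇒ᵇ-elim {lookup S x} (allF-elim n (∧-elimˡ (∧-elimʳ {size S ≡ᵇ size S} occSet)) x) Sx)

sumℤ-mapMaybe : {A B : Set} (g : B → ℤ) (f : A → Maybe B) (xs : List A) →
  sumℤ (map g (mapMaybe f xs)) ≡ sumℤ (map (maybe g (+ 0) ∘ f) xs)
sumℤ-mapMaybe g f [] = refl
sumℤ-mapMaybe g f (x ∷ xs) with f x
... | just y = cong (_+_ (g y)) (sumℤ-mapMaybe g f xs)
... | nothing = trans (sumℤ-mapMaybe g f xs) (sym (ℤₚ.+-identityˡ _))

sumℤ-concatMap : {A B : Set} (g : B → ℤ) (f : A → List B) (xs : List A) →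
  sumℤ (map g (concatMap f xs)) ≡ sumℤ (map (λ x → sumℤ (map g (f x))) xs)
sumℤ-concatMap g f [] = refl
sumℤ-concatMap g f (x ∷ xs) =
  trans (sumℤ-map-++ g (f x) (concatMap f xs)) (cong (_+_ (sumℤ (map g (f x)))) (sumℤ-concatMap g f xs))

sumℤ-tabulate-single : ∀ m (f : Fin m → ℤ) a → (∀ x → x ≢ a → f x ≡ + 0) → sumℤ (tabulate f) ≡ f a
sumℤ-tabulate-single (suc m) f zero f≗0 = trans
  (cong (_+_ (f zero)) (trans (cong sumℤ (sym (Listₚ.map-tabulate (λ x → x) (f ∘ suc))))
                              (sumℤ-map-zero (f ∘ suc) (allFin m) (λ x → f≗0 (suc x) λ ()))))
  (ℤₚ.+-identityʳ _)
sumℤ-tabulate-single (suc m) f (suc a) f≗0 = trans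
  (cong₂ _+_ (f≗0 zero λ ())
             (sumℤ-tabulate-single m (f ∘ suc) a (λ x x≢a → f≗0 (suc x) (x≢a ∘ Finₚ.suc-injective))))
  (ℤₚ.+-identityˡ _)

sumℤ-vecsOf-single : ∀ m k (f : Vec (Fin m) k → ℤ) w → (∀ v → v ≢ w → f v ≡ + 0) →
  sumℤ (map f (vecsOf (allFin m) k)) ≡ f w
sumℤ-vecsOf-single m zero f [] _ = ℤₚ.+-identityʳ _
sumℤ-vecsOf-single m (suc k) f (a ∷ w) f≗0 = begin
  sumℤ (map f (concatMap (λ x → map (x ∷_) V) (allFin m)))    ≡⟨ sumℤ-concatMap f _ (allFin m) ⟩
  sumℤ (map (λ x → sumℤ (map f (map (x ∷_) V))) (allFin m))   ≡⟨ cong sumℤ (Listₚ.map-tabulate (λ x → x) (sumℤ ∘ row)) ⟩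
  sumℤ (tabulate (λ x → sumℤ (map f (map (x ∷_) V))))          ≡⟨ sumℤ-tabulate-single m _ a off-head ⟩
  sumℤ (map f (map (a ∷_) V))                                 ≡⟨ sumℤ-map-∘ f (a ∷_) V ⟩
  sumℤ (map (f ∘ (a ∷_)) V)                                   ≡⟨ sumℤ-vecsOf-single m k (f ∘ (a ∷_)) w off-tail ⟩
  f (a ∷ w)                                                   ∎
  where
  open ≡-Reasoning
  V = vecsOf (allFin m) k
  row : Fin m → List ℤ
  row x = map f (map (x ∷_) V)
  off-head : ∀ x → x ≢ a → sumℤ (map f (map (x ∷_) V)) ≡ + 0
  off-head x x≢a = trans (sumℤ-map-∘ f (x ∷_) V) (sumℤ-map-zero _ V (λ v → f≗0 (x ∷ v) (x≢a ∘ cong Vec.head)))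
  off-tail : ∀ v → v ≢ w → f (a ∷ v) ≡ + 0
  off-tail v v≢w = f≗0 (a ∷ v) (v≢w ∘ cong Vec.tail)

-- allPerms filters vecsOf through a where-bound helper, which unification lets us name.
private
  allPerms-mapMaybe : ∃ λ (toPerm : ∀ m → Vec (Fin m) m → Maybe (Perm m)) →
    ∀ m → allPerms m ≡ mapMaybe (toPerm m) (vecsOf (allFin m) m)
  allPerms-mapMaybe = _ , λ m → refl

  toPerm : ∀ m → Vec (Fin m) m → Maybe (Perm m)
  toPerm = proj₁ allPerms-mapMaybe

  toPerm-spec : ∀ m v → (Σ (T (distinct v)) λ d → toPerm m v ≡ just (v , d)) ⊎ (¬ T (distinct v) × toPerm m v ≡ nothing)
  toPerm-spec m v with T? (distinct v)
  ... | yes d = inj₁ (d , refl)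
  ... | no ¬d = inj₂ (¬d , refl)

sumℤ-allPerms-single : ∀ m (f : Perm m → ℤ) σ → (∀ σ′ → σ′ ≢ σ → f σ′ ≡ + 0) →
  sumℤ (map f (allPerms m)) ≡ f σ
sumℤ-allPerms-single m f σ f≗0 = trans (sumℤ-mapMaybe f (toPerm m) (vecsOf (allFin m) m))
  (trans (sumℤ-vecsOf-single m m (maybe f (+ 0) ∘ toPerm m) (proj₁ σ) off) at-σ)
  where
  off : ∀ v → v ≢ proj₁ σ → maybe f (+ 0) (toPerm m v) ≡ + 0
  off v v≢σ with toPerm-spec m v
  ... | inj₁ (d , eq) rewrite eq = f≗0 (v , d) (v≢σ ∘ cong proj₁)
  ... | inj₂ (_ , eq) rewrite eq = refl
  at-σ : maybe f (+ 0) (toPerm m (proj₁ σ)) ≡ f σ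
  at-σ with toPerm-spec m (proj₁ σ)
  ... | inj₁ (d , eq) rewrite eq = cong (λ d′ → f (proj₁ σ , d′)) (T-irrelevant d (proj₂ σ))
  ... | inj₂ (¬d , _) = ⊥-elim (¬d (proj₂ σ))

sumℤ-applyUpTo-single : ∀ N (f : ℕ → ℤ) j → j < N → (∀ i → i ≢ j → f i ≡ + 0) → sumℤ (applyUpTo f N) ≡ f j
sumℤ-applyUpTo-single (suc N) f zero _ f≗0 = trans
  (cong (_+_ (f 0)) (trans (cong sumℤ (sym (Listₚ.map-applyUpTo (λ i → i) (f ∘ suc) N)))
                           (sumℤ-map-zero (f ∘ suc) (upTo N) (λ i → f≗0 (suc i) λ ()))))
  (ℤₚ.+-identityʳ _)
sumℤ-applyUpTo-single (suc N) f (suc j) (s≤s j<N) f≗0 = trans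
  (cong₂ _+_ (f≗0 0 λ ())
             (sumℤ-applyUpTo-single N (f ∘ suc) j j<N (λ i i≢j → f≗0 (suc i) (i≢j ∘ ℕₚ.suc-injective))))
  (ℤₚ.+-identityˡ _)

module _ (c : (m : ℕ) → Perm m → ℤ) {n : ℕ} (τ : Perm n) where
  private
    term : Vec Bool n → (m : ℕ) → Perm m → ℤ
    term S m σ = c m σ * 𝟙 (isOccurrenceSet (classical σ) τ S)

    termsOfSize : Vec Bool n → ℕ → ℤ
    termsOfSize S m = sumℤ (map (term S m) (allPerms m))

    termsOfSize-other : ∀ S m → m ≢ size S → termsOfSize S m ≡ + 0
    termsOfSize-other S m m≢ = sumℤ-map-zero _ (allPerms m) λ σ →
      trans (cong (λ b → c m σ * 𝟙 (b ∧ (formsPattern σ τ S ∧ avoidsShading (classical σ) τ S)))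
                  (≢⇒≡ᵇ-false (m≢ ∘ sym)))
            (ℤₚ.*-zeroʳ (c m σ))

    termsOfSize-size : ∀ S → termsOfSize S (size S) ≡ c (size S) (patternOf τ S)
    termsOfSize-size S = begin
      termsOfSize S (size S)
        ≡⟨ sumℤ-allPerms-single _ _ (patternOf τ S) off ⟩
      c (size S) (patternOf τ S) * 𝟙 (isOccurrenceSet (classical (patternOf τ S)) τ S)
        ≡⟨ cong (λ b → c (size S) (patternOf τ S) * 𝟙 b) (isOccurrenceSet-patternOf τ S) ⟩
      c (size S) (patternOf τ S) * + 1
        ≡⟨ ℤₚ.*-identityʳ _ ⟩
      c (size S) (patternOf τ S) ∎
      where
      open ≡-Reasoning
      off : ∀ σ → σ ≢ patternOf τ S → term S (size S) σ ≡ + 0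
      off σ σ≢ = trans
        (cong ((c (size S) σ *_) ∘ 𝟙) (≢true⇒≡false (σ≢ ∘ isOccurrenceSet-classical⇒≡patternOf τ S σ)))
        (ℤₚ.*-zeroʳ (c (size S) σ))

    c*occ≡sumSubsets : ∀ m σ → c m σ * + occ (classical σ) τ ≡ sumSubsets n (λ S → term S m σ)
    c*occ≡sumSubsets m σ = begin
      c m σ * + occ (classical σ) τ                             ≡⟨ cong (c m σ *_) (occ≡sumSubsets (classical σ) τ) ⟩
      c m σ * sumSubsets n (𝟙 ∘ isOcc (classical σ) τ)         ≡⟨ sumSubsets-*ˡ n (c m σ) _ ⟩
      sumSubsets n (λ S → c m σ * 𝟙 (isOcc (classical σ) τ S)) ≡⟨ sumSubsets-cong n (λ S →
                                                                    cong (λ b → c m σ * 𝟙 b) (isOcc≡isOccurrenceSet (classical σ) τ S)) ⟩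
      sumSubsets n (λ S → term S m σ)                           ∎
      where open ≡-Reasoning

  expand≡sumSubsets : expand c τ ≡ sumSubsets n (λ S → c (size S) (patternOf τ S))
  expand≡sumSubsets = begin
    expand c τ
      ≡⟨ sumℤ-map-cong (upTo (suc n)) (λ m → trans (sumℤ-map-cong (allPerms m) (c*occ≡sumSubsets m))
                                                   (sumℤ-map-sumSubsets n (λ σ S → term S m σ) (allPerms m))) ⟩
    sumℤ (map (λ m → sumSubsets n (λ S → termsOfSize S m)) (upTo (suc n)))
      ≡⟨ sumℤ-map-sumSubsets n (λ m S → termsOfSize S m) (upTo (suc n)) ⟩
    sumSubsets n (λ S → sumℤ (map (termsOfSize S) (upTo (suc n))))
      ≡⟨ sumSubsets-cong n (λ S → trans (cong sumℤ (Listₚ.map-applyUpTo (λ i → i) (termsOfSize S) (suc n)))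
           (sumℤ-applyUpTo-single (suc n) (termsOfSize S) (size S) (s≤s (size≤length S)) (termsOfSize-other S))) ⟩
    sumSubsets n (λ S → termsOfSize S (size S))
      ≡⟨ sumSubsets-cong n termsOfSize-size ⟩
    sumSubsets n (λ S → c (size S) (patternOf τ S)) ∎
    where open ≡-Reasoning

infix 4 _⊆ᵇ_ _⊆_

_⊆ᵇ_ : ∀ {n} → Vec Bool n → Vec Bool n → Bool
[] ⊆ᵇ [] = true
(s ∷ S) ⊆ᵇ (t ∷ T) = (s ⇒ᵇ t) ∧ (S ⊆ᵇ T)

_⊆_ : ∀ {n} → Vec Bool n → Vec Bool n → Set
S ⊆ T = ∀ x → lookup S x ≡ true → lookup T x ≡ true

⊆ᵇ⇒⊆ : ∀ {n} (S T : Vec Bool n) → (S ⊆ᵇ T) ≡ true → S ⊆ T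
⊆ᵇ⇒⊆ (true ∷ S) (true ∷ T) _ zero _ = refl
⊆ᵇ⇒⊆ (true ∷ S) (true ∷ T) h (suc x) Sx = ⊆ᵇ⇒⊆ S T h x Sx
⊆ᵇ⇒⊆ (false ∷ S) (t ∷ T) h (suc x) Sx = ⊆ᵇ⇒⊆ S T (∧-elimʳ {false ⇒ᵇ t} h) x Sx

⊆-tail : ∀ {n s t} {S T : Vec Bool n} → (s ∷ S) ⊆ (t ∷ T) → S ⊆ T
⊆-tail S⊆T x = S⊆T (suc x)

compress : ∀ {n} (T : Vec Bool n) → Vec Bool n → Vec Bool (size T)
compress [] [] = []
compress (true ∷ T) (s ∷ S) = s ∷ compress T S
compress (false ∷ T) (s ∷ S) = compress T S

sumSubsets-compress : ∀ {n} (T : Vec Bool n) (g : Vec Bool (size T) → ℤ) →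
  sumSubsets (size T) g ≡ sumSubsets n (λ S → 𝟙 (S ⊆ᵇ T) * g (compress T S))
sumSubsets-compress [] g = sym (ℤₚ.*-identityˡ (g []))
sumSubsets-compress (true ∷ T) g =
  cong₂ _+_ (sumSubsets-compress T (g ∘ (true ∷_))) (sumSubsets-compress T (g ∘ (false ∷_)))
sumSubsets-compress {suc n} (false ∷ T) g = trans (sumSubsets-compress T g) (sym (trans
  (cong (_+ sumSubsets n (λ S → 𝟙 (S ⊆ᵇ T) * g (compress T S)))
        (sumSubsets-zero n _ (λ S → ℤₚ.*-zeroˡ (g (compress T S)))))
  (ℤₚ.+-identityˡ _)))

size-compress : ∀ {n} (T S : Vec Bool n) → S ⊆ T → size (compress T S) ≡ size S
size-compress [] [] _ = refl
size-compress (true ∷ T) (s ∷ S) S⊆T = cong (𝟙ℕ s ℕ.+_) (size-compress T S (⊆-tail S⊆T))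
size-compress (false ∷ T) (false ∷ S) S⊆T = size-compress T S (⊆-tail S⊆T)
size-compress (false ∷ T) (true ∷ S) S⊆T with () ← S⊆T zero refl

lookup-compress : ∀ {n} (T S : Vec Bool n) i → lookup (compress T S) i ≡ lookup S (lookup (enumerate T) i)
lookup-compress (true ∷ T) (s ∷ S) zero = refl
lookup-compress (true ∷ T) (s ∷ S) (suc i) rewrite Vecₚ.lookup-map i Fin.suc (enumerate T) = lookup-compress T S i
lookup-compress (false ∷ T) (s ∷ S) i rewrite Vecₚ.lookup-map i Fin.suc (enumerate T) = lookup-compress T S i

rank-compress : ∀ {n} (T S : Vec Bool n) → S ⊆ T → ∀ x → lookup T x ≡ true →
  rank (compress T S) (rank T (toℕ x)) ≡ rank S (toℕ x)
rank-compress (true ∷ T) (s ∷ S) S⊆T zero _ = refl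
rank-compress (true ∷ T) (s ∷ S) S⊆T (suc x) Tx = cong (𝟙ℕ s ℕ.+_) (rank-compress T S (⊆-tail S⊆T) x Tx)
rank-compress (false ∷ T) (false ∷ S) S⊆T (suc x) Tx = rank-compress T S (⊆-tail S⊆T) x Tx
rank-compress (false ∷ T) (true ∷ S) S⊆T _ _ with () ← S⊆T zero refl

rank-cong : ∀ {n n′} (W : Vec Bool n) (W′ : Vec Bool n′) a → a ≤ n → a ≤ n′ →
  (∀ j (j<n : j < n) (j<n′ : j < n′) → j < a → lookup W (fromℕ< j<n) ≡ lookup W′ (fromℕ< j<n′)) →
  rank W a ≡ rank W′ a
rank-cong W W′ zero _ _ _ = trans (rank-zero W) (sym (rank-zero W′))
rank-cong W W′ (suc a) a<n a<n′ W≗W′ = begin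
  rank W (suc a)                               ≡⟨ rank-suc W a a<n ⟩
  rank W a ℕ.+ 𝟙ℕ (lookup W (fromℕ< a<n))      ≡⟨ cong₂ ℕ._+_ (rank-cong W W′ a (ℕₚ.<⇒≤ a<n) (ℕₚ.<⇒≤ a<n′)
                                                    (λ j p q j<a → W≗W′ j p q (ℕₚ.m<n⇒m<1+n j<a)))
                                                  (cong 𝟙ℕ (W≗W′ a a<n a<n′ (ℕₚ.n<1+n a))) ⟩
  rank W′ a ℕ.+ 𝟙ℕ (lookup W′ (fromℕ< a<n′))   ≡⟨ rank-suc W′ a a<n′ ⟨
  rank W′ (suc a)                              ∎
  where open ≡-Reasoning

-- Occurrences of the complement pattern in the pattern of a subset

allF-enumerate : ∀ {n} (T : Vec Bool n) (Φ : Fin (size T) → Bool) (Ψ : Fin n → Bool) →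
  (∀ i → Φ i ≡ Ψ (lookup (enumerate T) i)) → allF (size T) Φ ≡ allF n (λ x → lookup T x ⇒ᵇ Ψ x)
allF-enumerate {n} T Φ Ψ Φ≗Ψ = bool-ext
  (λ h → allF-intro n λ x → ⇒ᵇ-intro λ Tx → let (i , γi≡x) = Enumerates.onto E x Tx in
    subst (λ z → Ψ z ≡ true) γi≡x (trans (sym (Φ≗Ψ i)) (allF-elim (size T) h i)))
  (λ h → allF-intro (size T) λ i → trans (Φ≗Ψ i)
    (⇒ᵇ-elim {lookup T (lookup (enumerate T) i)} (allF-elim n h (lookup (enumerate T) i)) (Enumerates.marked E i)))
  where E = enumerate-Enumerates T

allShadedIn : Mesh → {n : ℕ} → Perm n → Vec Bool n → Vec Bool n → Bool
allShadedIn p {n} τ T S = allF n (λ x → (lookup T x ∧ not (lookup S x)) ⇒ᵇ shaded p (colRank S x) (rowRank τ S x))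

-- The occurrence condition of p̄ in the pattern of τ at T, read on positions of τ
isOccurrenceSetᶜ : (p : Mesh) {n : ℕ} → Perm n → Vec Bool n → Vec Bool n → Bool
isOccurrenceSetᶜ p τ T S = (size S ≡ᵇ k p) ∧ (formsPattern (π p) τ S ∧ allShadedIn p τ T S)

module _ {n : ℕ} (τ : Perm n) (T S : Vec Bool n) (S⊆T : S ⊆ T) where
  private
    σ = patternOf τ T
    e = enumerate T
    E = enumerate-Enumerates T
    U = compress T S
    VT = valueSet τ T
    VS = valueSet τ S
    module Pos = EnumeratesProperties E
    module Val = EnumeratesProperties (enumerate-Enumerates VT)
    open PatternOf τ T using (toℕ-patternVec)

    VS⊆VT : VS ⊆ VT
    VS⊆VT v VSv = trans (lookup-valueSet τ T v) (S⊆T (τ ⁻¹⟨ v ⟩) (trans (sym (lookup-valueSet τ S v)) VSv))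

    marked-value : ∀ i → lookup VT (τ ⟨ lookup e i ⟩) ≡ true
    marked-value i = trans (lookup-valueSet-⟨⟩ τ T _) (Enumerates.marked E i)

    valueSet-compress : ∀ j (j<m : j < size T) (j<m′ : j < size VT) →
      lookup (valueSet σ U) (fromℕ< j<m) ≡ lookup (compress VT VS) (fromℕ< j<m′)
    valueSet-compress j j<m j<m′ = begin
      lookup (valueSet σ U) (fromℕ< j<m)      ≡⟨ lookup-valueSet σ U _ ⟩
      lookup U i                              ≡⟨ lookup-compress T S i ⟩
      lookup S (lookup e i)                   ≡⟨ lookup-valueSet-⟨⟩ τ S _ ⟨
      lookup VS (τ ⟨ lookup e i ⟩)            ≡⟨ cong (lookup VS) v≡ ⟨
      lookup VS (lookup (enumerate VT) j′)    ≡⟨ lookup-compress VT VS j′ ⟨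
      lookup (compress VT VS) j′              ∎
      where
      open ≡-Reasoning
      i = σ ⁻¹⟨ fromℕ< j<m ⟩
      j′ = fromℕ< j<m′
      v≡ : lookup (enumerate VT) j′ ≡ τ ⟨ lookup e i ⟩
      v≡ = rank-injective VT _ _ (Enumerates.marked (enumerate-Enumerates VT) j′) (marked-value i) (begin
        rank VT (toℕ (lookup (enumerate VT) j′)) ≡⟨ Val.rank-entry j′ ⟩
        toℕ j′                                    ≡⟨ Finₚ.toℕ-fromℕ< j<m′ ⟩
        j                                         ≡⟨ Finₚ.toℕ-fromℕ< j<m ⟨
        toℕ (fromℕ< j<m)                          ≡⟨ cong toℕ (⟨⁻¹⟨⟩⟩ σ (fromℕ< j<m)) ⟨
        toℕ (σ ⟨ i ⟩)                             ≡⟨ toℕ-patternVec i ⟩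
        rowRank τ T (lookup e i)                  ∎)

  colRank-compress : ∀ i → colRank U i ≡ colRank S (lookup e i)
  colRank-compress i = trans (cong (rank U) (sym (Pos.rank-entry i))) (rank-compress T S S⊆T (lookup e i) (Enumerates.marked E i))

  rowRank-compress : ∀ i → rowRank σ U i ≡ rowRank τ S (lookup e i)
  rowRank-compress i = begin
    rank (valueSet σ U) (toℕ (σ ⟨ i ⟩))       ≡⟨ rank-cong (valueSet σ U) (compress VT VS) _ σi≤ σi≤′
                                                    (λ j p q _ → valueSet-compress j p q) ⟩
    rank (compress VT VS) (toℕ (σ ⟨ i ⟩))     ≡⟨ cong (rank (compress VT VS)) (toℕ-patternVec i) ⟩
    rank (compress VT VS) (rowRank τ T (lookup e i)) ≡⟨ rank-compress VT VS VS⊆VT (τ ⟨ lookup e i ⟩) (marked-value i) ⟩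
    rowRank τ S (lookup e i)                  ∎
    where
    open ≡-Reasoning
    σi≤ = ℕₚ.<⇒≤ (Finₚ.toℕ<n (σ ⟨ i ⟩))
    σi≤′ = subst (toℕ (σ ⟨ i ⟩) ≤_) (sym (size-valueSet τ T)) σi≤

  formsPattern-compress : ∀ {m} (π′ : Perm m) → formsPattern π′ σ U ≡ formsPattern π′ τ S
  formsPattern-compress π′ = trans
    (allF-enumerate T _ Ψ (λ i → cong₂ _⇒ᵇ_ (lookup-compress T S i)
                                   (cong₂ _≡ᵇ_ (cong (permℕ π′) (colRank-compress i)) (rowRank-compress i))))
    (allF-cong n λ x → T⇒Ψ≡Ψ x)
    where
    Ψ : Fin n → Bool
    Ψ x = lookup S x ⇒ᵇ (permℕ π′ (colRank S x) ≡ᵇ rowRank τ S x)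
    T⇒Ψ≡Ψ : ∀ x → (lookup T x ⇒ᵇ Ψ x) ≡ Ψ x
    T⇒Ψ≡Ψ x with lookup T x in Tx | lookup S x in Sx
    ... | true | _ = refl
    ... | false | false = refl
    ... | false | true = ⊥-elim (true≢false (S⊆T x Sx) Tx)

  avoidsShading-complement-compress : ∀ p → avoidsShading (complement p) σ U ≡ allShadedIn p τ T S
  avoidsShading-complement-compress p = trans
    (allF-enumerate T _ Ψ (λ i → cong₂ (λ b c → not b ⇒ᵇ not (not c)) (lookup-compress T S i)
                                   (cong₂ (shaded p) (colRank-compress i) (rowRank-compress i))))
    (allF-cong n λ x → curry-⇒ᵇ (lookup T x) (lookup S x) (shaded p (colRank S x) (rowRank τ S x)))
    where
    Ψ : Fin n → Bool
    Ψ x = not (lookup S x) ⇒ᵇ not (not (shaded p (colRank S x) (rowRank τ S x)))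
    curry-⇒ᵇ : ∀ a b r → (a ⇒ᵇ (not b ⇒ᵇ not (not r))) ≡ ((a ∧ not b) ⇒ᵇ r)
    curry-⇒ᵇ true true r = refl
    curry-⇒ᵇ true false true = refl
    curry-⇒ᵇ true false false = refl
    curry-⇒ᵇ false b r = refl

  isOccurrenceSet-complement-compress : ∀ p → isOccurrenceSet (complement p) σ U ≡ isOccurrenceSetᶜ p τ T S
  isOccurrenceSet-complement-compress p = cong₂ _∧_ (cong (_≡ᵇ k p) (size-compress T S S⊆T))
    (cong₂ _∧_ (formsPattern-compress (π p)) (avoidsShading-complement-compress p))

-- Inclusion–exclusion over supersets

sign : ∀ {n} → Vec Bool n → Vec Bool n → ℤ
sign [] [] = + 1
sign (true ∷ S) (t ∷ T) = sign S T
sign (false ∷ S) (true ∷ T) = - sign S T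
sign (false ∷ S) (false ∷ T) = sign S T

size-mono : ∀ {n} (S T : Vec Bool n) → S ⊆ T → size S ≤ size T
size-mono [] [] _ = z≤n
size-mono (true ∷ S) (true ∷ T) S⊆T = s≤s (size-mono S T (⊆-tail S⊆T))
size-mono (true ∷ S) (false ∷ T) S⊆T with () ← S⊆T zero refl
size-mono (false ∷ S) (true ∷ T) S⊆T = ℕₚ.m≤n⇒m≤1+n (size-mono S T (⊆-tail S⊆T))
size-mono (false ∷ S) (false ∷ T) S⊆T = size-mono S T (⊆-tail S⊆T)

sign≡-1^ : ∀ {n} (S T : Vec Bool n) → S ⊆ T → sign S T ≡ (- + 1) ^ (size T ∸ size S)
sign≡-1^ [] [] _ = refl
sign≡-1^ (true ∷ S) (true ∷ T) S⊆T = sign≡-1^ S T (⊆-tail S⊆T)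
sign≡-1^ (true ∷ S) (false ∷ T) S⊆T with () ← S⊆T zero refl
sign≡-1^ (false ∷ S) (true ∷ T) S⊆T = begin
  - sign S T                                   ≡⟨ cong -_ (sign≡-1^ S T (⊆-tail S⊆T)) ⟩
  - ((- + 1) ^ (size T ∸ size S))              ≡⟨ ℤₚ.-1*i≡-i _ ⟨
  (- + 1) * (- + 1) ^ (size T ∸ size S)         ≡⟨ cong ((- + 1) ^_) (ℕₚ.+-∸-assoc 1 (size-mono S T (⊆-tail S⊆T))) ⟨
  (- + 1) ^ (suc (size T) ∸ size S)             ∎
  where open ≡-Reasoning
sign≡-1^ (false ∷ S) (false ∷ T) S⊆T = sign≡-1^ S T (⊆-tail S⊆T)

allF-suc : ∀ n (P : Fin (suc n) → Bool) → allF (suc n) P ≡ P zero ∧ allF n (P ∘ suc)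
allF-suc n P = bool-ext
  (λ h → ∧-intro (allF-elim (suc n) h zero) (allF-intro n (allF-elim (suc n) h ∘ suc)))
  (λ h → allF-intro (suc n) λ where
    zero → ∧-elimˡ h
    (suc i) → allF-elim n (∧-elimʳ {P zero} h) i)

OutsideSatisfy : ∀ {n} → (Fin n → Bool) → Vec Bool n → Vec Bool n → Bool
OutsideSatisfy {n} Q S T = allF n (λ x → (lookup T x ∧ not (lookup S x)) ⇒ᵇ Q x)

OutsideSatisfy-∷ : ∀ {n} (Q : Fin (suc n) → Bool) s t (S T : Vec Bool n) →
  OutsideSatisfy Q (s ∷ S) (t ∷ T) ≡ ((t ∧ not s) ⇒ᵇ Q zero) ∧ OutsideSatisfy (Q ∘ suc) S T
OutsideSatisfy-∷ {n} Q s t S T = allF-suc n (λ x → (lookup (t ∷ T) x ∧ not (lookup (s ∷ S) x)) ⇒ᵇ Q x)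

OutsideFail : ∀ {n} → (Fin n → Bool) → Vec Bool n → Bool
OutsideFail {n} Q S = allF n (λ x → not (lookup S x) ⇒ᵇ not (Q x))

OutsideFail-∷ : ∀ {n} (Q : Fin (suc n) → Bool) s (S : Vec Bool n) →
  OutsideFail Q (s ∷ S) ≡ (not s ⇒ᵇ not (Q zero)) ∧ OutsideFail (Q ∘ suc) S
OutsideFail-∷ {n} Q s S = allF-suc n (λ x → not (lookup (s ∷ S) x) ⇒ᵇ not (Q x))

*-neg-middle : ∀ x y z → x * (- y * z) ≡ - (x * (y * z))
*-neg-middle = solve-∀

sumSubsets-alternating : ∀ n (S : Vec Bool n) (Q : Fin n → Bool) →
  sumSubsets n (λ T → 𝟙 (S ⊆ᵇ T) * (sign S T * 𝟙 (OutsideSatisfy Q S T))) ≡ 𝟙 (OutsideFail Q S)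
sumSubsets-alternating zero [] Q = refl
sumSubsets-alternating (suc n) (true ∷ S) Q = begin
  sumSubsets n (λ T → 𝟙 (S ⊆ᵇ T) * (sign S T * 𝟙 (OutsideSatisfy Q (true ∷ S) (true ∷ T))))
    + sumSubsets n (λ T → + 0 * (sign (true ∷ S) (false ∷ T) * 𝟙 (OutsideSatisfy Q (true ∷ S) (false ∷ T))))
    ≡⟨ cong₂ _+_ (sumSubsets-cong n (λ T → cong (λ b → 𝟙 (S ⊆ᵇ T) * (sign S T * 𝟙 b)) (OutsideSatisfy-∷ Q true true S T)))
                 (sumSubsets-zero n _ (λ T → ℤₚ.*-zeroˡ (sign S T * 𝟙 (OutsideSatisfy Q (true ∷ S) (false ∷ T))))) ⟩
  sumSubsets n (λ T → 𝟙 (S ⊆ᵇ T) * (sign S T * 𝟙 (OutsideSatisfy (Q ∘ suc) S T))) + + 0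
    ≡⟨ trans (ℤₚ.+-identityʳ _) (sumSubsets-alternating n S (Q ∘ suc)) ⟩
  𝟙 (OutsideFail (Q ∘ suc) S)
    ≡⟨ cong 𝟙 (OutsideFail-∷ Q true S) ⟨
  𝟙 (OutsideFail Q (true ∷ S)) ∎
  where open ≡-Reasoning
sumSubsets-alternating (suc n) (false ∷ S) Q = begin
  sumSubsets n (λ T → 𝟙 (S ⊆ᵇ T) * (- sign S T * 𝟙 (OutsideSatisfy Q (false ∷ S) (true ∷ T))))
    + sumSubsets n (λ T → 𝟙 (S ⊆ᵇ T) * (sign S T * 𝟙 (OutsideSatisfy Q (false ∷ S) (false ∷ T))))
    ≡⟨ cong₂ _+_ (sumSubsets-cong n (λ T → cong (λ b → 𝟙 (S ⊆ᵇ T) * (- sign S T * 𝟙 b)) (OutsideSatisfy-∷ Q false true S T)))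
                 (sumSubsets-cong n (λ T → cong (λ b → 𝟙 (S ⊆ᵇ T) * (sign S T * 𝟙 b)) (OutsideSatisfy-∷ Q false false S T))) ⟩
  sumSubsets n (λ T → 𝟙 (S ⊆ᵇ T) * (- sign S T * 𝟙 (Q zero ∧ Rest T))) + G
    ≡⟨ split (Q zero) ⟩
  𝟙 ((not (Q zero)) ∧ OutsideFail (Q ∘ suc) S)
    ≡⟨ cong 𝟙 (OutsideFail-∷ Q false S) ⟨
  𝟙 (OutsideFail Q (false ∷ S)) ∎
  where
  open ≡-Reasoning
  Rest = OutsideSatisfy (Q ∘ suc) S
  G = sumSubsets n (λ T → 𝟙 (S ⊆ᵇ T) * (sign S T * 𝟙 (Rest T)))
  split : ∀ q → sumSubsets n (λ T → 𝟙 (S ⊆ᵇ T) * (- sign S T * 𝟙 (q ∧ Rest T))) + G ≡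
                𝟙 (not q ∧ OutsideFail (Q ∘ suc) S)
  split true = begin
    sumSubsets n (λ T → 𝟙 (S ⊆ᵇ T) * (- sign S T * 𝟙 (Rest T))) + G
      ≡⟨ cong (_+ G) (trans (sumSubsets-cong n (λ T → *-neg-middle (𝟙 (S ⊆ᵇ T)) (sign S T) (𝟙 (Rest T))))
                            (sumSubsets-neg n _)) ⟩
    - G + G ≡⟨ ℤₚ.+-inverseˡ G ⟩
    + 0     ∎
  split false = begin
    sumSubsets n (λ T → 𝟙 (S ⊆ᵇ T) * (- sign S T * + 0)) + G
      ≡⟨ cong (_+ G) (sumSubsets-zero n _ λ T →
           trans (cong (𝟙 (S ⊆ᵇ T) *_) (ℤₚ.*-zeroʳ (- sign S T))) (ℤₚ.*-zeroʳ (𝟙 (S ⊆ᵇ T)))) ⟩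
    + 0 + G ≡⟨ ℤₚ.+-identityˡ G ⟩
    G       ≡⟨ sumSubsets-alternating n S (Q ∘ suc) ⟩
    𝟙 (OutsideFail (Q ∘ suc) S) ∎

𝟙-*-cong : ∀ b {x y} → (b ≡ true → x ≡ y) → 𝟙 b * x ≡ 𝟙 b * y
𝟙-*-cong true x≡y = cong (+ 1 *_) (x≡y refl)
𝟙-*-cong false _ = refl

*-𝟙-swap : ∀ s s′ b x → (b ≡ true → s ≡ s′) → s * 𝟙 b * x ≡ 𝟙 b * (s′ * x)
*-𝟙-swap s s′ true x s≡s′ rewrite s≡s′ refl | ℤₚ.*-identityʳ s′ = sym (ℤₚ.*-identityˡ (s′ * x))
*-𝟙-swap s s′ false x _ rewrite ℤₚ.*-zeroʳ s = ℤₚ.*-zeroˡ x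

sumSubsets-𝟙-∧ : ∀ n a (w : Vec Bool n → ℤ) (r : Vec Bool n → Bool) b →
  (a ≡ true → sumSubsets n (λ T → w T * 𝟙 (r T)) ≡ 𝟙 b) →
  sumSubsets n (λ T → w T * 𝟙 (a ∧ r T)) ≡ 𝟙 (a ∧ b)
sumSubsets-𝟙-∧ n true w r b h = h refl
sumSubsets-𝟙-∧ n false w r b _ = sumSubsets-zero n _ (λ T → ℤₚ.*-zeroʳ (w T))

module _ (p : Mesh) {n : ℕ} (τ : Perm n) where
  private
    K = k p

    weight : Vec Bool n → Vec Bool n → ℤ
    weight S T = (- + 1) ^ (size T ∸ K) * 𝟙 (S ⊆ᵇ T)

  occ-complement-patternOf : ∀ T →
    + occ (complement p) (patternOf τ T) ≡ sumSubsets n (λ S → 𝟙 (S ⊆ᵇ T) * 𝟙 (isOccurrenceSetᶜ p τ T S))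
  occ-complement-patternOf T = begin
    + occ (complement p) (patternOf τ T)
      ≡⟨ occ≡sumSubsets (complement p) (patternOf τ T) ⟩
    sumSubsets (size T) (𝟙 ∘ isOcc (complement p) (patternOf τ T))
      ≡⟨ sumSubsets-cong (size T) (cong 𝟙 ∘ isOcc≡isOccurrenceSet (complement p) (patternOf τ T)) ⟩
    sumSubsets (size T) (𝟙 ∘ isOccurrenceSet (complement p) (patternOf τ T))
      ≡⟨ sumSubsets-compress T _ ⟩
    sumSubsets n (λ S → 𝟙 (S ⊆ᵇ T) * 𝟙 (isOccurrenceSet (complement p) (patternOf τ T) (compress T S)))
      ≡⟨ sumSubsets-cong n (λ S → 𝟙-*-cong (S ⊆ᵇ T) λ S⊆ᵇT →
           cong 𝟙 (isOccurrenceSet-complement-compress τ T S (⊆ᵇ⇒⊆ S T S⊆ᵇT) p)) ⟩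
    sumSubsets n (λ S → 𝟙 (S ⊆ᵇ T) * 𝟙 (isOccurrenceSetᶜ p τ T S)) ∎
    where open ≡-Reasoning

  lam-patternOf : ∀ T → lam p (size T) (patternOf τ T) ≡ sumSubsets n (λ S → weight S T * 𝟙 (isOccurrenceSetᶜ p τ T S))
  lam-patternOf T = begin
    (- + 1) ^ (size T ∸ K) * + occ (complement p) (patternOf τ T)
      ≡⟨ cong ((- + 1) ^ (size T ∸ K) *_) (occ-complement-patternOf T) ⟩
    (- + 1) ^ (size T ∸ K) * sumSubsets n (λ S → 𝟙 (S ⊆ᵇ T) * 𝟙 (isOccurrenceSetᶜ p τ T S))
      ≡⟨ sumSubsets-*ˡ n ((- + 1) ^ (size T ∸ K)) (λ S → 𝟙 (S ⊆ᵇ T) * 𝟙 (isOccurrenceSetᶜ p τ T S)) ⟩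
    sumSubsets n (λ S → (- + 1) ^ (size T ∸ K) * (𝟙 (S ⊆ᵇ T) * 𝟙 (isOccurrenceSetᶜ p τ T S)))
      ≡⟨ sumSubsets-cong n (λ S →
           sym (ℤₚ.*-assoc ((- + 1) ^ (size T ∸ K)) (𝟙 (S ⊆ᵇ T)) (𝟙 (isOccurrenceSetᶜ p τ T S)))) ⟩
    sumSubsets n (λ S → weight S T * 𝟙 (isOccurrenceSetᶜ p τ T S)) ∎
    where open ≡-Reasoning

  -- Since |S| = k, the weight (-1)^{|T|-k} is the sign (-1)^{|T∖S|} of inclusion–exclusion.
  sumSubsets-weight-allShadedIn : ∀ S → size S ≡ K →
    sumSubsets n (λ T → weight S T * 𝟙 (allShadedIn p τ T S)) ≡ 𝟙 (avoidsShading p τ S)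
  sumSubsets-weight-allShadedIn S size≡K = trans
    (sumSubsets-cong n λ T → *-𝟙-swap ((- + 1) ^ (size T ∸ K)) (sign S T) (S ⊆ᵇ T) (𝟙 (allShadedIn p τ T S)) λ S⊆ᵇT →
      trans (cong (λ m → (- + 1) ^ (size T ∸ m)) (sym size≡K)) (sym (sign≡-1^ S T (⊆ᵇ⇒⊆ S T S⊆ᵇT))))
    (sumSubsets-alternating n S (λ x → shaded p (colRank S x) (rowRank τ S x)))

  sumSubsets-weight-isOccurrenceSetᶜ : ∀ S →
    sumSubsets n (λ T → weight S T * 𝟙 (isOccurrenceSetᶜ p τ T S)) ≡ 𝟙 (isOccurrenceSet p τ S)
  sumSubsets-weight-isOccurrenceSetᶜ S =
    sumSubsets-𝟙-∧ n (size S ≡ᵇ K) (weight S) (λ T → formsPattern (π p) τ S ∧ allShadedIn p τ T S) _ λ size≡ᵇK →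
    sumSubsets-𝟙-∧ n (formsPattern (π p) τ S) (weight S) (λ T → allShadedIn p τ T S) _ λ _ →
    sumSubsets-weight-allShadedIn S (≡ᵇ-elim size≡ᵇK)

  occ≡expand-lam : + occ p τ ≡ expand (lam p) τ
  occ≡expand-lam = sym (begin
    expand (lam p) τ
      ≡⟨ expand≡sumSubsets (lam p) τ ⟩
    sumSubsets n (λ T → lam p (size T) (patternOf τ T))
      ≡⟨ sumSubsets-cong n lam-patternOf ⟩
    sumSubsets n (λ T → sumSubsets n (λ S → weight S T * 𝟙 (isOccurrenceSetᶜ p τ T S)))
      ≡⟨ sumSubsets-swap n n _ ⟩
    sumSubsets n (λ S → sumSubsets n (λ T → weight S T * 𝟙 (isOccurrenceSetᶜ p τ T S)))
      ≡⟨ sumSubsets-cong n sumSubsets-weight-isOccurrenceSetᶜ ⟩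
    sumSubsets n (𝟙 ∘ isOccurrenceSet p τ)
      ≡⟨ sumSubsets-cong n (cong 𝟙 ∘ isOcc≡isOccurrenceSet p τ) ⟨
    sumSubsets n (𝟙 ∘ isOcc p τ)
      ≡⟨ occ≡sumSubsets p τ ⟨
    + occ p τ ∎)
    where open ≡-Reasoning

-- Uniqueness

full : ∀ n → Vec Bool n
full n = Vec.replicate n true

size-full : ∀ n → size (full n) ≡ n
size-full zero = refl
size-full (suc n) = cong suc (size-full n)

size<length : ∀ {n} (T : Vec Bool n) → T ≢ full n → size T < n
size<length [] T≢full = ⊥-elim (T≢full refl)
size<length (true ∷ T) T≢full = s<s (size<length T (T≢full ∘ cong (true ∷_)))
size<length (false ∷ T) _ = s≤s (size≤length T)

rank-full-vec : ∀ n a → a ≤ n → rank (full n) a ≡ a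
rank-full-vec zero zero _ = refl
rank-full-vec (suc n) zero _ = refl
rank-full-vec (suc n) (suc a) (s≤s a≤n) = cong suc (rank-full-vec n a a≤n)

valueSet-full : ∀ {m} (σ : Perm m) → valueSet σ (full m) ≡ full m
valueSet-full {m} σ = lookup-ext _ _ λ v →
  trans (lookup-valueSet σ (full m) v)
        (trans (Vecₚ.lookup-replicate (σ ⁻¹⟨ v ⟩) true) (sym (Vecₚ.lookup-replicate v true)))

toℕ-subst : ∀ {a b} (a≡b : a ≡ b) (i : Fin a) → toℕ (subst Fin a≡b i) ≡ toℕ i
toℕ-subst refl i = refl

Σ-perm-≡ : ∀ {m′} m (m′≡m : m′ ≡ m) (σ′ : Perm m′) (σ : Perm m) →
  (∀ i → toℕ (σ′ ⟨ i ⟩) ≡ toℕ (σ ⟨ subst Fin m′≡m i ⟩)) → _≡_ {A = Σ ℕ Perm} (m′ , σ′) (m , σ)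
Σ-perm-≡ m refl σ′ σ σ′≗σ = cong (m ,_) (perm-≡ σ′ σ (Finₚ.toℕ-injective ∘ σ′≗σ))

patternOf-full : ∀ {m} (σ : Perm m) → _≡_ {A = Σ ℕ Perm} (size (full m) , patternOf σ (full m)) (m , σ)
patternOf-full {m} σ = Σ-perm-≡ m (size-full m) (patternOf σ (full m)) σ λ i →
  let e = lookup (enumerate (full m)) i in begin
  toℕ (patternOf σ (full m) ⟨ i ⟩)               ≡⟨ toℕ-patternVec i ⟩
  rank (valueSet σ (full m)) (toℕ (σ ⟨ e ⟩))     ≡⟨ cong (λ W → rank W (toℕ (σ ⟨ e ⟩))) (valueSet-full σ) ⟩
  rank (full m) (toℕ (σ ⟨ e ⟩))                  ≡⟨ rank-full-vec m _ (ℕₚ.<⇒≤ (Finₚ.toℕ<n _)) ⟩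
  toℕ (σ ⟨ e ⟩)                                  ≡⟨ cong (toℕ ∘ σ ⟨_⟩) (enumerate-full i) ⟩
  toℕ (σ ⟨ subst Fin (size-full m) i ⟩)          ∎
  where
  open ≡-Reasoning
  open PatternOf σ (full m) using (toℕ-patternVec)
  enumerate-full : ∀ i → lookup (enumerate (full m)) i ≡ subst Fin (size-full m) i
  enumerate-full i = Finₚ.toℕ-injective (begin
    toℕ (lookup (enumerate (full m)) i)                  ≡⟨ rank-full-vec m _ (ℕₚ.<⇒≤ (Finₚ.toℕ<n _)) ⟨
    rank (full m) (toℕ (lookup (enumerate (full m)) i))  ≡⟨ EnumeratesProperties.rank-entry (enumerate-Enumerates (full m)) i ⟩
    toℕ i                                                ≡⟨ toℕ-subst (size-full m) i ⟨
    toℕ (subst Fin (size-full m) i)                      ∎)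

sumSubsets-agree-at : ∀ n (f g : Vec Bool n → ℤ) W → sumSubsets n f ≡ sumSubsets n g →
  (∀ T → T ≢ W → f T ≡ g T) → f W ≡ g W
sumSubsets-agree-at n f g W Σf≡Σg f≗g = ℤₚ.i-j≡0⇒i≡j (f W) (g W) (begin
  f W - g W
    ≡⟨ sumSubsets-single n (λ T → f T - g T) W (λ T T≢W → ℤₚ.i≡j⇒i-j≡0 (f≗g T T≢W)) ⟨
  sumSubsets n (λ T → f T - g T)     ≡⟨ sumSubsets-+ n f (λ T → - g T) ⟩
  sumSubsets n f + sumSubsets n (λ T → - g T) ≡⟨ cong₂ _+_ Σf≡Σg (sumSubsets-neg n g) ⟩
  sumSubsets n g - sumSubsets n g    ≡⟨ ℤₚ.+-inverseʳ (sumSubsets n g) ⟩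
  + 0                                ∎)
  where open ≡-Reasoning

expand-injective : (μ ν : (m : ℕ) → Perm m → ℤ) → (∀ n (τ : Perm n) → expand μ τ ≡ expand ν τ) →
  ∀ m (σ : Perm m) → μ m σ ≡ ν m σ
expand-injective μ ν expand≡ = <-rec (λ m → ∀ σ → μ m σ ≡ ν m σ) step
  where
  step : ∀ m → (∀ {j} → j < m → ∀ σ → μ j σ ≡ ν j σ) → ∀ σ → μ m σ ≡ ν m σ
  step m shorter σ = begin
    μ m σ                                 ≡⟨ cong (λ (j , σ′) → μ j σ′) (patternOf-full σ) ⟨
    μ (size (full m)) (patternOf σ (full m)) ≡⟨ sumSubsets-agree-at m _ _ (full m) sums off-full ⟩
    ν (size (full m)) (patternOf σ (full m)) ≡⟨ cong (λ (j , σ′) → ν j σ′) (patternOf-full σ) ⟩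
    ν m σ                                 ∎
    where
    open ≡-Reasoning
    sums : sumSubsets m (λ T → μ (size T) (patternOf σ T)) ≡ sumSubsets m (λ T → ν (size T) (patternOf σ T))
    sums = trans (sym (expand≡sumSubsets μ σ)) (trans (expand≡ m σ) (expand≡sumSubsets ν σ))
    off-full : ∀ T → T ≢ full m → μ (size T) (patternOf σ T) ≡ ν (size T) (patternOf σ T)
    off-full T T≢full = shorter (size<length T T≢full) (patternOf σ T)

mainTheorem1 : (p : Mesh) →
    ((n : ℕ) (τ : Perm n) → + occ p τ ≡ expand (lam p) τ)
    × ((μ : (m : ℕ) → Perm m → ℤ) →
         ((n : ℕ) (τ : Perm n) → + occ p τ ≡ expand μ τ) →
         (m : ℕ) (σ : Perm m) → μ m σ ≡ lam p m σ)
mainTheorem1 p = (λ n τ → occ≡expand-lam p τ) , uniqueness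
  where
  uniqueness : (μ : (m : ℕ) → Perm m → ℤ) → ((n : ℕ) (τ : Perm n) → + occ p τ ≡ expand μ τ) →
    (m : ℕ) (σ : Perm m) → μ m σ ≡ lam p m σ
  uniqueness μ occ≡expand-μ = expand-injective μ (lam p) λ n τ →
    trans (sym (occ≡expand-μ n τ)) (occ≡expand-lam p τ)
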